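{- For every integer $n\ge 2$, the entries in the first row of the adjugate matrix $(I_n-xA_n)^*$ are $$(I_n-xA_n)^*_{1,j}=\begin{cases}P_{n-2}(x), & j=1,\\ xP_{n-2j+1}(-x), & 1<j<\lfloor\frac{n+1}{2}\rfloor+1,\\ xP_{2j-n-2}(x), & \lfloor\frac{n+1}{2}\rfloor<j\le n.\end{cases}$$
   Context: $A_n$ is the $n\times n$ matrix with $(i,j)$ entry $1$ if $i+j\le n+1$ and $0$ otherwise. For a square matrix $B$, $B^*$ denotes its adjugate (classical adjoint, the transpose of the cofactor matrix), so $B^*_{1,j}$ is the $(j,1)$ cofactor of $B$. For $n\in\mathbb{N}$, $P_n(x)=\sum_{k=0}^{n}(-1)^{\lfloor 3k/2\rfloor}\binom{\lfloor (n+k)/2\rfloor}{k}x^k$ (so $P_0=1$). -}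

module Defs where

open import Level using (Level)
open import Data.Nat as ℕ using (ℕ; zero; suc; _<?_)
open import Data.Nat.DivMod using (_/_)
open import Data.Nat.Combinatorics using (_C_)
open import Data.Fin using (Fin; zero; suc; toℕ; punchIn)
import Data.Fin
open import Relation.Nullary.Decidable using (does)
open import Data.Bool using (if_then_else_)
open import Algebra.Bundles using (CommutativeRing)

module WithRing {c ℓ : Level} (R : CommutativeRing c ℓ) where
  open CommutativeRing R hiding (zero)

  Matrix : ℕ → Set c
  Matrix n = Fin n → Fin n → Carrier

  sumF : ∀ {n} → (Fin n → Carrier) → Carrier
  sumF {zero}  f = 0#
  sumF {suc n} f = f zero + sumF (λ i → f (suc i))

  sgn : ℕ → Carrier
  sgn zero    = 1#
  sgn (suc k) = - sgn k

  pow : Carrier → ℕ → Carrier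
  pow x zero    = 1#
  pow x (suc k) = x * pow x k

  fromℕ : ℕ → Carrier
  fromℕ zero    = 0#
  fromℕ (suc k) = 1# + fromℕ k

  minor : ∀ {n} → Fin (suc n) → Fin (suc n) → Matrix (suc n) → Matrix n
  minor i j M r s = M (punchIn i r) (punchIn j s)

  det : ∀ {n} → Matrix n → Carrier
  det {zero}  M = 1#
  det {suc n} M = sumF (λ j → sgn (toℕ j) * (M zero j * det (minor zero j M)))

  cofactor : ∀ {n} → Matrix n → Fin n → Fin n → Carrier
  cofactor {suc n} M i j = sgn (toℕ i ℕ.+ toℕ j) * det (minor i j M)

  adj : ∀ {n} → Matrix n → Matrix n
  adj M i j = cofactor M j i

  -- A_n (0-indexed): entry 1 iff (i+1)+(j+1) ≤ n+1, i.e. i+j < n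
  A : (n : ℕ) → Matrix n
  A n i j = if does (toℕ i ℕ.+ toℕ j <? n) then 1# else 0#

  idM : (n : ℕ) → Matrix n
  idM n i j = if does (i Data.Fin.≟ j) then 1# else 0#

  IxA : Carrier → (n : ℕ) → Matrix n
  IxA x n i j = idM n i j - x * A n i j

  P : ℕ → Carrier → Carrier
  P n x = sumF {suc n} (λ k → sgn ((3 ℕ.* toℕ k) / 2)
                             * (fromℕ (((n ℕ.+ toℕ k) / 2) C toℕ k) * pow x (toℕ k)))

{-# OPTIONS --safe #-}
-- Subtracting from every row of I − xAₙ the next one leaves a bidiagonal matrix (1 on the
-- diagonal, −1 above it) minus x on the antidiagonal.  Adding x times its first row to its last
-- row and expanding along the first column expresses its determinant, and that of the same matrix
-- with last row e₀, through the two matrices of this kind two sizes smaller; the resulting pair of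
-- recurrences is the one satisfied by (Pₙ(x), Pₙ₋₁(−x)) because Pₙ₊₂(y) = Pₙ(y) − y Pₙ₊₁(−y).
-- Hence det(I − xAₙ) = Pₙ(x).
-- The first row of the adjugate consists of the signed minors obtained by deleting the first
-- column and row j.  Expanding such a minor along its last row (a unit vector) and then along
-- row 2 minus row 1 (also a unit vector) gives the minor for row j − 1 of I − xAₙ₋₂.  This
-- reduces every entry to the cases j = 1, j = 2 and j = n, where the minor is a combination of
-- the determinants det(I − xAₖ).
module Submission where

open import Defs
open import Level using (Level)
open import Algebra.Bundles using (CommutativeRing)
import Data.Nat as ℕ
open import Data.Nat using (ℕ; zero; suc; s≤s; z≤n)
import Data.Nat.Properties as ℕP
import Data.Nat.DivMod as ℕDM
open import Relation.Binary.PropositionalEquality as ≡ using (_≡_; _≢_)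

module IndexArithmetic where
  open import Data.Nat.DivMod using (_/_; _%_)
  open import Data.Nat using (_≤_; _<_; _∸_; _+_; _*_)
  open import Data.Product using (_×_; _,_)
  open import Data.Nat.Tactic.RingSolver using (solve-∀)

  2*[n/2]≤n : ∀ n → 2 * (n / 2) ≤ n
  2*[n/2]≤n n = ≡.subst (_≤ n) (ℕP.*-comm (n / 2) 2) (ℕDM.m/n*n≤m n 2)

  middle-size : ∀ t n → suc (suc t) < (n + 1) / 2 + 1 →
    n ≡ 3 + (t + t + (n + 1 ∸ 2 * suc (suc t)))
  middle-size t n lt = ℕP.suc-injective (begin
      suc n                                        ≡⟨ ℕP.+-comm 1 n ⟩
      n + 1                                        ≡⟨ ℕP.m+[n∸m]≡n 2[t+2]≤n+1 ⟨
      2 * suc (suc t) + (n + 1 ∸ 2 * suc (suc t))  ≡⟨ reshape t _ ⟩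
      suc (3 + (t + t + (n + 1 ∸ 2 * suc (suc t)))) ∎)
    where
    open ≡.≡-Reasoning
    reshape : ∀ t s → 2 * suc (suc t) + s ≡ suc (3 + (t + t + s))
    reshape = solve-∀
    2[t+2]≤n+1 : 2 * suc (suc t) ≤ n + 1
    2[t+2]≤n+1 = ℕP.≤-trans (ℕP.*-monoʳ-≤ 2 (ℕP.≤-pred (≡.subst (suc (suc (suc t)) ≤_) (ℕP.+-comm _ 1) lt)))
                           (2*[n/2]≤n (n + 1))

  ⌊3[k+2]/2⌋≡⌊3k/2⌋+3 : ∀ k → (3 * suc (suc k)) / 2 ≡ (3 * k) / 2 + 3
  ⌊3[k+2]/2⌋≡⌊3k/2⌋+3 k = begin
      (3 * suc (suc k)) / 2  ≡⟨ ≡.cong (_/ 2) (ℕP.*-distribˡ-+ 3 2 k) ⟩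
      (6 + 3 * k) / 2        ≡⟨ ℕDM.m/n≡1+[m∸n]/n {m = 6 + 3 * k} (s≤s (s≤s z≤n)) ⟩
      suc ((4 + 3 * k) / 2)  ≡⟨ ≡.cong suc (ℕDM.m/n≡1+[m∸n]/n {m = 4 + 3 * k} (s≤s (s≤s z≤n))) ⟩
      2 + (2 + 3 * k) / 2    ≡⟨ ≡.cong (2 +_) (ℕDM.m/n≡1+[m∸n]/n {m = 2 + 3 * k} (s≤s (s≤s z≤n))) ⟩
      3 + (3 * k) / 2        ≡⟨ ℕP.+-comm 3 _ ⟩
      (3 * k) / 2 + 3        ∎
    where open ≡.≡-Reasoning

  n+2≤2*m : ∀ n m → (n + 1) / 2 < m → n + 2 ≤ 2 * m
  n+2≤2*m n m lt = begin
      n + 2                   ≡⟨ succ n ⟩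
      suc (n + 1)             ≡⟨ ≡.cong suc (ℕDM.m≡m%n+[m/n]*n (n + 1) 2) ⟩
      suc (r + q * 2)         ≤⟨ s≤s (ℕP.+-monoˡ-≤ (q * 2) (ℕP.≤-pred (ℕDM.m%n<n (n + 1) 2))) ⟩
      suc (1 + q * 2)         ≡⟨ double-succ q ⟩
      2 * suc q               ≤⟨ ℕP.*-monoʳ-≤ 2 lt ⟩
      2 * m                   ∎
    where
    open ℕP.≤-Reasoning
    succ : ∀ n → n + 2 ≡ suc (n + 1)
    succ = solve-∀
    double-succ : ∀ q → suc (1 + q * 2) ≡ 2 * suc q
    double-succ = solve-∀
    q = (n + 1) / 2
    r = (n + 1) % 2

  upper-size : ∀ n u → (n + 1) / 2 < suc u → suc u ≤ n →
    let d = n ∸ suc u; s = 2 * suc u ∸ (n + 2)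
    in n ≡ 2 + (d + d + s) × u ≡ suc (d + s)
  upper-size n u half<1+u 1+u≤n = n≡ , ℕP.suc-injective m≡
    where
    open ≡.≡-Reasoning
    m = suc u
    d = n ∸ m
    s = 2 * m ∸ (n + 2)
    m+d≡n : m + d ≡ n
    m+d≡n = ℕP.m+[n∸m]≡n 1+u≤n
    double : ∀ m → 2 * m ≡ m + m
    double = solve-∀
    reassoc : ∀ m d s → m + d + 2 + s ≡ m + suc (suc (d + s))
    reassoc = solve-∀
    m≡ : m ≡ suc (suc (d + s))
    m≡ = ℕP.+-cancelˡ-≡ m m _ (begin
      m + m                 ≡⟨ double m ⟨
      2 * m                 ≡⟨ ℕP.m+[n∸m]≡n (n+2≤2*m n m half<1+u) ⟨
      n + 2 + s             ≡⟨ ≡.cong (λ k → k + 2 + s) m+d≡n ⟨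
      m + d + 2 + s         ≡⟨ reassoc m d s ⟩
      m + suc (suc (d + s)) ∎)
    reshape : ∀ d s → suc (suc (d + s)) + d ≡ 2 + (d + d + s)
    reshape = solve-∀
    n≡ : n ≡ 2 + (d + d + s)
    n≡ = begin
      n                      ≡⟨ m+d≡n ⟨
      m + d                  ≡⟨ ≡.cong (_+ d) m≡ ⟩
      suc (suc (d + s)) + d  ≡⟨ reshape d s ⟩
      2 + (d + d + s)        ∎

module PunchIn where
  open import Data.Nat using (_≤_; _<_)
  open import Data.Fin as Fin using (Fin; zero; suc; toℕ; punchIn)
  import Data.Fin.Properties as FinP

  punchInℕ : ℕ → ℕ → ℕ
  punchInℕ zero    a       = suc a
  punchInℕ (suc i) zero    = zero
  punchInℕ (suc i) (suc a) = suc (punchInℕ i a)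

  toℕ-punchIn : ∀ {n} (i : Fin (suc n)) (r : Fin n) → toℕ (punchIn i r) ≡ punchInℕ (toℕ i) (toℕ r)
  toℕ-punchIn zero    r       = ≡.refl
  toℕ-punchIn (suc i) zero    = ≡.refl
  toℕ-punchIn (suc i) (suc r) = ≡.cong suc (toℕ-punchIn i r)

  punchInℕ-< : ∀ i a → a < i → punchInℕ i a ≡ a
  punchInℕ-< (suc i) zero    _         = ≡.refl
  punchInℕ-< (suc i) (suc a) (s≤s a<i) = ≡.cong suc (punchInℕ-< i a a<i)

  punchInℕ-≥ : ∀ i a → i ≤ a → punchInℕ i a ≡ suc a
  punchInℕ-≥ zero    a       _         = ≡.refl
  punchInℕ-≥ (suc i) (suc a) (s≤s i≤a) = ≡.cong suc (punchInℕ-≥ i a i≤a)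

  toℕ-punchIn-last : ∀ {n} (r : Fin n) → toℕ (punchIn (Fin.fromℕ n) r) ≡ toℕ r
  toℕ-punchIn-last {n} r = ≡.trans (toℕ-punchIn (Fin.fromℕ n) r)
    (punchInℕ-< _ _ (≡.subst (toℕ r <_) (≡.sym (FinP.toℕ-fromℕ n)) (FinP.toℕ<n r)))

-- The ring solver needs a coefficient ring mapped into R; ℤ maps into every commutative ring.
module IntegerCoefficients {c ℓ : Level} (R : CommutativeRing c ℓ) where
  open CommutativeRing R
  open import Algebra.Properties.Ring ring using (-0#≈0#; -‿involutive; -‿+-comm; -1*x≈-x)
  open import Algebra.Properties.Semiring.Mult.TCOptimised semiring using (_×_; ×-homo-+; ×1-homo-*)
  open import Relation.Binary.Reasoning.Setoid setoid
  open import Data.Integer as ℤ using (ℤ; +_; -[1+_]; _⊖_)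
  import Data.Integer.Properties as ℤP
  open import Data.Sign as Sign using (Sign)
  open import Data.Maybe using (Maybe; just; nothing)
  open import Relation.Nullary using (yes; no)
  import Algebra.Solver.Ring.AlmostCommutativeRing as ACR

  ⟦_⟧ : ℤ → Carrier
  ⟦ + n ⟧      = n × 1#
  ⟦ -[1+ n ] ⟧ = - (suc n × 1#)

  private
    ⟦_⟧ₛ : Sign → Carrier
    ⟦ Sign.+ ⟧ₛ = 1#
    ⟦ Sign.- ⟧ₛ = - 1#

    suc-homo : ∀ n → suc n × 1# ≈ 1# + n × 1#
    suc-homo n = ×-homo-+ 1# 1 n

    [1+a]-[1+b] : ∀ a b → (1# + a) - (1# + b) ≈ a - b
    [1+a]-[1+b] a b = begin
      (1# + a) - (1# + b)     ≈⟨ +-congˡ (-‿+-comm 1# b) ⟨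
      (1# + a) + (- 1# + - b) ≈⟨ +-assoc 1# a _ ⟩
      1# + (a + (- 1# + - b)) ≈⟨ +-congˡ (+-congˡ (+-comm _ _)) ⟩
      1# + (a + (- b + - 1#)) ≈⟨ +-congˡ (+-assoc a _ _) ⟨
      1# + ((a - b) + - 1#)   ≈⟨ +-congˡ (+-comm _ _) ⟩
      1# + (- 1# + (a - b))   ≈⟨ +-assoc 1# _ _ ⟨
      (1# - 1#) + (a - b)     ≈⟨ +-congʳ (-‿inverseʳ 1#) ⟩
      0# + (a - b)            ≈⟨ +-identityˡ _ ⟩
      a - b                   ∎

  ⊖-homo : ∀ m n → ⟦ m ⊖ n ⟧ ≈ m × 1# - n × 1#
  ⊖-homo m       zero    = sym (trans (+-congˡ -0#≈0#) (+-identityʳ _))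
  ⊖-homo zero    (suc n) = sym (+-identityˡ _)
  ⊖-homo (suc m) (suc n) = begin
    ⟦ suc m ⊖ suc n ⟧           ≡⟨ ≡.cong ⟦_⟧ (ℤP.[1+m]⊖[1+n]≡m⊖n m n) ⟩
    ⟦ m ⊖ n ⟧                   ≈⟨ ⊖-homo m n ⟩
    m × 1# - n × 1#             ≈⟨ [1+a]-[1+b] _ _ ⟨
    (1# + m × 1#) - (1# + n × 1#) ≈⟨ +-cong (suc-homo m) (-‿cong (suc-homo n)) ⟨
    suc m × 1# - suc n × 1#     ∎

  +-homo : ∀ i j → ⟦ i ℤ.+ j ⟧ ≈ ⟦ i ⟧ + ⟦ j ⟧
  +-homo (+ m)    (+ n)    = ×-homo-+ 1# m n
  +-homo (+ m)    -[1+ n ] = ⊖-homo m (suc n)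
  +-homo -[1+ m ] (+ n)    = trans (⊖-homo n (suc m)) (+-comm _ _)
  +-homo -[1+ m ] -[1+ n ] = begin
    - (suc (suc (m ℕ.+ n)) × 1#)         ≡⟨ ≡.cong (λ k → - (suc k × 1#)) (ℕP.+-suc m n) ⟨
    - ((suc m ℕ.+ suc n) × 1#)           ≈⟨ -‿cong (×-homo-+ 1# (suc m) (suc n)) ⟩
    - (suc m × 1# + suc n × 1#)        ≈⟨ -‿+-comm _ _ ⟨
    - (suc m × 1#) + - (suc n × 1#)    ∎

  -‿homo : ∀ i → ⟦ ℤ.- i ⟧ ≈ - ⟦ i ⟧
  -‿homo (+ zero)  = sym -0#≈0#
  -‿homo (+ suc n) = refl
  -‿homo -[1+ n ]  = sym (-‿involutive _)

  private
    ◃-homo : ∀ s n → ⟦ s ℤ.◃ n ⟧ ≈ ⟦ s ⟧ₛ * n × 1#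
    ◃-homo s      zero    = sym (zeroʳ _)
    ◃-homo Sign.+ (suc n) = sym (*-identityˡ _)
    ◃-homo Sign.- (suc n) = sym (-1*x≈-x _)

    sign-abs : ∀ i → ⟦ i ⟧ ≈ ⟦ ℤ.sign i ⟧ₛ * ℤ.∣ i ∣ × 1#
    sign-abs (+ n)    = sym (*-identityˡ _)
    sign-abs -[1+ n ] = sym (-1*x≈-x _)

    sign-homo : ∀ s t → ⟦ s Sign.* t ⟧ₛ ≈ ⟦ s ⟧ₛ * ⟦ t ⟧ₛ
    sign-homo Sign.+ t      = sym (*-identityˡ _)
    sign-homo Sign.- Sign.+ = sym (*-identityʳ _)
    sign-homo Sign.- Sign.- = sym (trans (-1*x≈-x _) (-‿involutive 1#))

    interchange : ∀ a b c d → (a * b) * (c * d) ≈ (a * c) * (b * d)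
    interchange a b c d = begin
      (a * b) * (c * d) ≈⟨ *-assoc a b _ ⟩
      a * (b * (c * d)) ≈⟨ *-congˡ (*-assoc b c d) ⟨
      a * ((b * c) * d) ≈⟨ *-congˡ (*-congʳ (*-comm b c)) ⟩
      a * ((c * b) * d) ≈⟨ *-congˡ (*-assoc c b d) ⟩
      a * (c * (b * d)) ≈⟨ *-assoc a c _ ⟨
      (a * c) * (b * d) ∎

  *-homo : ∀ i j → ⟦ i ℤ.* j ⟧ ≈ ⟦ i ⟧ * ⟦ j ⟧
  *-homo i j = begin
    ⟦ i ℤ.* j ⟧
      ≈⟨ ◃-homo (ℤ.sign i Sign.* ℤ.sign j) (ℤ.∣ i ∣ ℕ.* ℤ.∣ j ∣) ⟩
    ⟦ ℤ.sign i Sign.* ℤ.sign j ⟧ₛ * (ℤ.∣ i ∣ ℕ.* ℤ.∣ j ∣) × 1#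
      ≈⟨ *-cong (sign-homo (ℤ.sign i) (ℤ.sign j)) (×1-homo-* ℤ.∣ i ∣ ℤ.∣ j ∣) ⟩
    (⟦ ℤ.sign i ⟧ₛ * ⟦ ℤ.sign j ⟧ₛ) * (ℤ.∣ i ∣ × 1# * ℤ.∣ j ∣ × 1#)
      ≈⟨ interchange _ _ _ _ ⟩
    (⟦ ℤ.sign i ⟧ₛ * ℤ.∣ i ∣ × 1#) * (⟦ ℤ.sign j ⟧ₛ * ℤ.∣ j ∣ × 1#)
      ≈⟨ *-cong (sign-abs i) (sign-abs j) ⟨
    ⟦ i ⟧ * ⟦ j ⟧
      ∎

  homomorphism : ℤ.+-*-rawRing ACR.-Raw-AlmostCommutative⟶ ACR.fromCommutativeRing R
  homomorphism = record
    { ⟦_⟧    = ⟦_⟧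
    ; +-homo = +-homo
    ; *-homo = *-homo
    ; -‿homo = -‿homo
    ; 0-homo = refl
    ; 1-homo = refl
    }

  ⟦⟧-cong-≡ : ∀ i j → Maybe (⟦ i ⟧ ≈ ⟦ j ⟧)
  ⟦⟧-cong-≡ i j with i ℤ.≟ j
  ... | yes i≡j = just (reflexive (≡.cong ⟦_⟧ i≡j))
  ... | no _    = nothing

  open import Algebra.Solver.Ring ℤ.+-*-rawRing (ACR.fromCommutativeRing R) homomorphism ⟦⟧-cong-≡
    using (solve; _:+_; _:*_; _:-_; :-_; _:=_; con) public

module Determinant {c ℓ : Level} (R : CommutativeRing c ℓ) where
  open CommutativeRing R hiding (zero)
  open WithRing R
  open IntegerCoefficients R using (solve; _:+_; _:*_; _:-_; :-_; _:=_; con)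
  open import Algebra.Properties.Ring ring using (-0#≈0#; -‿+-comm; -1*x≈-x; -‿distribˡ-*; +-inverseʳ-unique)
  open import Relation.Binary.Reasoning.Setoid setoid
  open import Data.Fin as Fin using (Fin; zero; suc; toℕ; punchIn; punchOut)
  import Data.Fin.Properties as FinP
  open import Data.Product using (_×_; _,_; proj₁; proj₂)
  open import Data.Sum using (_⊎_; inj₁; inj₂)
  open import Data.Empty using (⊥-elim)
  open import Relation.Nullary using (yes; no)
  open import Function using (_∘_)
  open import Data.Integer using (+_)
  open PunchIn

  -a*-b≈a*b : ∀ a b → (- a) * (- b) ≈ a * b
  -a*-b≈a*b = solve 2 (λ a b → (:- a) :* (:- b) := a :* b) refl

  sgn-+ : ∀ a b → sgn (a ℕ.+ b) ≈ sgn a * sgn b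
  sgn-+ zero    b = sym (*-identityˡ _)
  sgn-+ (suc a) b = trans (-‿cong (sgn-+ a b)) (-‿distribˡ-* _ _)

  sgn-square : ∀ a → sgn a * sgn a ≈ 1#
  sgn-square zero    = *-identityˡ 1#
  sgn-square (suc a) = trans (-a*-b≈a*b _ _) (sgn-square a)

  sumF-cong : ∀ {n} {f g : Fin n → Carrier} → (∀ i → f i ≈ g i) → sumF f ≈ sumF g
  sumF-cong {zero}  f≈g = refl
  sumF-cong {suc n} f≈g = +-cong (f≈g zero) (sumF-cong (λ i → f≈g (suc i)))

  sumF-+ : ∀ {n} (f g : Fin n → Carrier) → sumF (λ i → f i + g i) ≈ sumF f + sumF g
  sumF-+ {zero}  f g = sym (+-identityʳ 0#)
  sumF-+ {suc n} f g = trans (+-congˡ (sumF-+ (λ i → f (suc i)) (λ i → g (suc i)))) (interchange _ _ _ _)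
    where
    interchange : ∀ a b c d → (a + b) + (c + d) ≈ (a + c) + (b + d)
    interchange = solve 4 (λ a b c d → (a :+ b) :+ (c :+ d) := (a :+ c) :+ (b :+ d)) refl

  sumF-* : ∀ {n} (a : Carrier) (f : Fin n → Carrier) → sumF (λ i → a * f i) ≈ a * sumF f
  sumF-* {zero}  a f = sym (zeroʳ a)
  sumF-* {suc n} a f = trans (+-congˡ (sumF-* a (λ i → f (suc i)))) (sym (distribˡ a _ _))

  sumF-neg : ∀ {n} (f : Fin n → Carrier) → sumF (λ i → - f i) ≈ - sumF f
  sumF-neg {zero}  f = sym -0#≈0#
  sumF-neg {suc n} f = trans (+-congˡ (sumF-neg (λ i → f (suc i)))) (-‿+-comm (f zero) _)

  sumF-zero : ∀ {n} {f : Fin n → Carrier} → (∀ i → f i ≈ 0#) → sumF f ≈ 0#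
  sumF-zero {zero}  f≈0 = refl
  sumF-zero {suc n} f≈0 = trans (+-cong (f≈0 zero) (sumF-zero (λ i → f≈0 (suc i)))) (+-identityʳ 0#)

  sumF-single : ∀ {n} (f : Fin n → Carrier) (k : Fin n) → (∀ i → i ≢ k → f i ≈ 0#) → sumF f ≈ f k
  sumF-single {suc n} f zero    f≈0 = trans (+-congˡ (sumF-zero (λ i → f≈0 (suc i) λ ()))) (+-identityʳ _)
  sumF-single {suc n} f (suc k) f≈0 =
    trans (+-cong (f≈0 zero λ ()) (sumF-single (λ i → f (suc i)) k (λ i i≢k → f≈0 (suc i) (i≢k ∘ FinP.suc-injective))))
          (+-identityˡ _)

  -- (j , k) ↦ (j , punchIn j k) enumerates the pairs of distinct indices; the hypothesis says
  -- that G changes sign when the two indices of such a pair are exchanged.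
  sumF-antisymmetric : ∀ m (G : Fin (suc m) → Fin m → Carrier) →
    (∀ j k j′ k′ → punchIn j k ≡ j′ → punchIn j′ k′ ≡ j → G j k ≈ - G j′ k′) →
    sumF (λ j → sumF (G j)) ≈ 0#
  sumF-antisymmetric zero    G anti = +-identityʳ 0#
  sumF-antisymmetric (suc m) G anti = begin
      sumF (G zero) + sumF (λ j → G (suc j) zero + sumF (λ k → G (suc j) (suc k)))
    ≈⟨ +-congˡ (sumF-+ (λ j → G (suc j) zero) (λ j → sumF (λ k → G (suc j) (suc k)))) ⟩
      sumF (G zero) + (sumF (λ j → G (suc j) zero) + sumF (λ j → sumF (λ k → G (suc j) (suc k))))
    ≈⟨ +-cong (sumF-cong (λ k → anti zero k (suc k) zero ≡.refl ≡.refl)) (+-congˡ inner) ⟩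
      sumF (λ k → - G (suc k) zero) + (sumF (λ j → G (suc j) zero) + 0#)
    ≈⟨ +-cong (sumF-neg (λ k → G (suc k) zero)) (+-identityʳ _) ⟩
      - sumF (λ j → G (suc j) zero) + sumF (λ j → G (suc j) zero)
    ≈⟨ -‿inverseˡ _ ⟩
      0# ∎
    where
    inner : sumF (λ j → sumF (λ k → G (suc j) (suc k))) ≈ 0#
    inner = sumF-antisymmetric m (λ j k → G (suc j) (suc k))
              (λ j k j′ k′ e e′ → anti (suc j) (suc k) (suc j′) (suc k′) (≡.cong suc e) (≡.cong suc e′))

  punchIn-exchange : ∀ {n} (j : Fin (suc (suc n))) (k k′ : Fin (suc n)) → punchIn (punchIn j k) k′ ≡ j →
    ∀ s → punchIn j (punchIn k s) ≡ punchIn (punchIn j k) (punchIn k′ s)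
  punchIn-exchange zero    k       zero     e s       = ≡.refl
  punchIn-exchange (suc j) zero    k′       e s       = ≡.cong (λ t → suc (punchIn t s)) (≡.sym (FinP.suc-injective e))
  punchIn-exchange (suc j) (suc k) (suc k′) e zero    = ≡.refl
  punchIn-exchange (suc j) (suc k) (suc k′) e (suc s) = ≡.cong suc (punchIn-exchange j k k′ (FinP.suc-injective e) s)

  sgn-punchIn-exchange : ∀ {n} (j : Fin (suc (suc n))) (k k′ : Fin (suc n)) → punchIn (punchIn j k) k′ ≡ j →
    sgn (toℕ j) * sgn (toℕ k) ≈ - (sgn (toℕ (punchIn j k)) * sgn (toℕ k′))
  sgn-punchIn-exchange zero    k       zero     e = a≈--a (sgn (toℕ k))
    where
    a≈--a : ∀ a → 1# * a ≈ - ((- a) * 1#)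
    a≈--a = solve 1 (λ a → con (+ 1) :* a := :- ((:- a) :* con (+ 1))) refl
  sgn-punchIn-exchange (suc j) zero    k′       e =
    ≡.subst (λ t → (- sgn (toℕ j)) * 1# ≈ - (1# * sgn (toℕ t))) (≡.sym (FinP.suc-injective e)) (-a*1≈-[1*a] _)
    where
    -a*1≈-[1*a] : ∀ a → (- a) * 1# ≈ - (1# * a)
    -a*1≈-[1*a] = solve 1 (λ a → (:- a) :* con (+ 1) := :- (con (+ 1) :* a)) refl
  sgn-punchIn-exchange {zero}  (suc j) (suc ()) (suc k′) e
  sgn-punchIn-exchange {suc n} (suc j) (suc k)  (suc k′) e =
    trans (-a*-b≈a*b _ _) (trans (sgn-punchIn-exchange j k k′ (FinP.suc-injective e)) (-‿cong (sym (-a*-b≈a*b _ _))))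

  expansionTerm : ∀ {n} → Matrix (suc n) → Fin (suc n) → Carrier
  expansionTerm M j = sgn (toℕ j) * (M zero j * det (minor zero j M))

  det-cong : ∀ {n} {M N : Matrix n} → (∀ i j → M i j ≈ N i j) → det M ≈ det N
  det-cong {zero}  M≈N = refl
  det-cong {suc n} {M} {N} M≈N = sumF-cong {f = expansionTerm M} {g = expansionTerm N} (λ j → *-congˡ (*-cong (M≈N zero j)
    (det-cong {M = minor zero j M} {N = minor zero j N} (λ r s → M≈N (suc r) (punchIn j s)))))

  -- Expanding along row 0 and then row 1 gives a sum over pairs of distinct columns whose terms cancel.
  det-rows₀₁-equal : ∀ {n} (M : Matrix (suc (suc n))) → (∀ s → M zero s ≈ M (suc zero) s) → det M ≈ 0#
  det-rows₀₁-equal {n} M row₀≈row₁ = begin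
      det M
    ≈⟨ sumF-cong {f = expansionTerm M} (λ j → trans (*-congˡ (sym (sumF-* (M zero j) (H j))))
                                                    (sym (sumF-* (sgn (toℕ j)) (λ k → M zero j * H j k)))) ⟩
      sumF (λ j → sumF (G j))
    ≈⟨ sumF-antisymmetric (suc n) G anti ⟩
      0# ∎
    where
    D : Fin (suc (suc n)) → Fin (suc n) → Carrier
    D j k = det (minor zero k (minor zero j M))
    H G : Fin (suc (suc n)) → Fin (suc n) → Carrier
    H j k = sgn (toℕ k) * (M (suc zero) (punchIn j k) * D j k)
    G j k = sgn (toℕ j) * (M zero j * H j k)
    regroup : ∀ s t a q d → s * (a * (t * (q * d))) ≈ (s * t) * ((a * q) * d)
    regroup = solve 5 (λ s t a q d → s :* (a :* (t :* (q :* d))) := (s :* t) :* ((a :* q) :* d)) refl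
    regroup′ : ∀ u v a q d → (- (u * v)) * ((a * q) * d) ≈ - (u * (q * (v * (a * d))))
    regroup′ = solve 5 (λ u v a q d → (:- (u :* v)) :* ((a :* q) :* d) := :- (u :* (q :* (v :* (a :* d))))) refl
    anti : ∀ j k j′ k′ → punchIn j k ≡ j′ → punchIn j′ k′ ≡ j → G j k ≈ - G j′ k′
    anti j k .(punchIn j k) k′ ≡.refl e = begin
        G j k
      ≈⟨ regroup _ _ _ _ _ ⟩
        (sgn (toℕ j) * sgn (toℕ k)) * ((M zero j * M (suc zero) (punchIn j k)) * D j k)
      ≈⟨ *-cong (sgn-punchIn-exchange j k k′ e)
                (*-congˡ (det-cong (λ r s → reflexive (≡.cong (M _) (punchIn-exchange j k k′ e s))))) ⟩
        (- (sgn (toℕ (punchIn j k)) * sgn (toℕ k′))) * ((M zero j * M (suc zero) (punchIn j k)) * D (punchIn j k) k′)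
      ≈⟨ regroup′ _ _ _ _ _ ⟩
        - (sgn (toℕ (punchIn j k)) * (M (suc zero) (punchIn j k) * (sgn (toℕ k′) * (M zero j * D (punchIn j k) k′))))
      ≈⟨ -‿cong (*-congˡ (*-cong (sym (row₀≈row₁ _))
                                 (*-congˡ (*-congʳ (trans (row₀≈row₁ j) (reflexive (≡.cong (M (suc zero)) (≡.sym e)))))))) ⟩
        - G (punchIn j k) k′ ∎

  det-linear-row : ∀ {n} (i : Fin n) (a : Carrier) (M N P : Matrix n) →
    (∀ r → r ≢ i → ∀ s → (P r s ≈ M r s) × (P r s ≈ N r s)) →
    (∀ s → P i s ≈ M i s + a * N i s) → det P ≈ det M + a * det N
  det-linear-row {suc n} zero a M N P others row = begin
      det P
    ≈⟨ sumF-cong {f = expansionTerm P} (λ j → trans (*-congˡ (*-congʳ (row j))) (split _ _ a _ _)) ⟩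
      sumF (λ j → T₁ j + a * T₂ j)
    ≈⟨ trans (sumF-+ T₁ (λ j → a * T₂ j)) (+-congˡ (sumF-* a T₂)) ⟩
      sumF T₁ + a * sumF T₂
    ≈⟨ +-cong (sumF-cong {f = T₁} {g = expansionTerm M} (λ j → *-congˡ (*-congˡ
                (det-cong {M = minor zero j P} {N = minor zero j M} (λ r s → proj₁ (others (suc r) (λ ()) (punchIn j s)))))))
              (*-congˡ (sumF-cong {f = T₂} {g = expansionTerm N} (λ j → *-congˡ (*-congˡ
                (det-cong {M = minor zero j P} {N = minor zero j N} (λ r s → proj₂ (others (suc r) (λ ()) (punchIn j s)))))))) ⟩
      det M + a * det N ∎
    where
    T₁ T₂ : Fin (suc n) → Carrier
    T₁ j = sgn (toℕ j) * (M zero j * det (minor zero j P))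
    T₂ j = sgn (toℕ j) * (N zero j * det (minor zero j P))
    split : ∀ s m a n d → s * ((m + a * n) * d) ≈ s * (m * d) + a * (s * (n * d))
    split = solve 5 (λ s m a n d → s :* ((m :+ a :* n) :* d) := s :* (m :* d) :+ a :* (s :* (n :* d))) refl
  det-linear-row {suc n} (suc i) a M N P others row = begin
      det P
    ≈⟨ sumF-cong {f = expansionTerm P} (λ j → trans (*-congˡ (*-cong (proj₁ (others zero (λ ()) j)) (minors j)))
                                                    (split _ _ a _ _)) ⟩
      sumF (λ j → expansionTerm M j + a * T j)
    ≈⟨ trans (sumF-+ (expansionTerm M) (λ j → a * T j)) (+-congˡ (sumF-* a T)) ⟩
      det M + a * sumF T
    ≈⟨ +-congˡ (*-congˡ (sumF-cong {f = T} {g = expansionTerm N} (λ j → *-congˡ (*-congʳ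
         (trans (sym (proj₁ (others zero (λ ()) j))) (proj₂ (others zero (λ ()) j))))))) ⟩
      det M + a * det N ∎
    where
    T : Fin (suc n) → Carrier
    T j = sgn (toℕ j) * (M zero j * det (minor zero j N))
    split : ∀ s m a dm dn → s * (m * (dm + a * dn)) ≈ s * (m * dm) + a * (s * (m * dn))
    split = solve 5 (λ s m a dm dn → s :* (m :* (dm :+ a :* dn)) := s :* (m :* dm) :+ a :* (s :* (m :* dn))) refl
    minors : ∀ j → det (minor zero j P) ≈ det (minor zero j M) + a * det (minor zero j N)
    minors j = det-linear-row i a (minor zero j M) (minor zero j N) (minor zero j P)
      (λ r r≢i s → others (suc r) (r≢i ∘ FinP.suc-injective) (punchIn j s)) (λ s → row (punchIn j s))

  withRows₀₁ : ∀ {n} → Matrix (suc (suc n)) → (u v : Fin (suc (suc n)) → Carrier) → Matrix (suc (suc n))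
  withRows₀₁ M u v zero          = u
  withRows₀₁ M u v (suc zero)    = v
  withRows₀₁ M u v (suc (suc r)) = M (suc (suc r))

  det-additive-row : ∀ {n} (i : Fin n) (M N P : Matrix n) →
    (∀ r → r ≢ i → ∀ s → (P r s ≈ M r s) × (P r s ≈ N r s)) →
    (∀ s → P i s ≈ M i s + N i s) → det P ≈ det M + det N
  det-additive-row i M N P others row =
    trans (det-linear-row i 1# M N P others (λ s → trans (row s) (+-congˡ (sym (*-identityˡ _)))))
          (+-congˡ (*-identityˡ _))

  det-additive-row₀ : ∀ {n} (M : Matrix (suc (suc n))) u v w →
    det (withRows₀₁ M (λ s → u s + v s) w) ≈ det (withRows₀₁ M u w) + det (withRows₀₁ M v w)
  det-additive-row₀ M u v w = det-additive-row zero (withRows₀₁ M u w) (withRows₀₁ M v w) _ others (λ s → refl)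
    where
    others : ∀ r → r ≢ zero → ∀ s → (withRows₀₁ M (λ s → u s + v s) w r s ≈ withRows₀₁ M u w r s)
                                   × (withRows₀₁ M (λ s → u s + v s) w r s ≈ withRows₀₁ M v w r s)
    others zero          r≢0 s = ⊥-elim (r≢0 ≡.refl)
    others (suc zero)    r≢0 s = refl , refl
    others (suc (suc r)) r≢0 s = refl , refl

  det-additive-row₁ : ∀ {n} (M : Matrix (suc (suc n))) u v w →
    det (withRows₀₁ M w (λ s → u s + v s)) ≈ det (withRows₀₁ M w u) + det (withRows₀₁ M w v)
  det-additive-row₁ M u v w = det-additive-row (suc zero) (withRows₀₁ M w u) (withRows₀₁ M w v) _ others (λ s → refl)
    where
    others : ∀ r → r ≢ suc zero → ∀ s → (withRows₀₁ M w (λ s → u s + v s) r s ≈ withRows₀₁ M w u r s)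
                                       × (withRows₀₁ M w (λ s → u s + v s) r s ≈ withRows₀₁ M w v r s)
    others zero          r≢1 s = refl , refl
    others (suc zero)    r≢1 s = ⊥-elim (r≢1 ≡.refl)
    others (suc (suc r)) r≢1 s = refl , refl

  det-swap₀₁ : ∀ {n} (M : Matrix (suc (suc n))) → det (withRows₀₁ M (M (suc zero)) (M zero)) ≈ - det M
  det-swap₀₁ M = +-inverseʳ-unique (det M) _ (sym (begin
      0#
    ≈⟨ det-rows₀₁-equal (withRows₀₁ M w w) (λ s → refl) ⟨
      det (withRows₀₁ M w w)
    ≈⟨ det-additive-row₀ M u v w ⟩
      det (withRows₀₁ M u w) + det (withRows₀₁ M v w)
    ≈⟨ +-cong (det-additive-row₁ M u v u) (det-additive-row₁ M u v v) ⟩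
      (det (withRows₀₁ M u u) + det (withRows₀₁ M u v)) + (det (withRows₀₁ M v u) + det (withRows₀₁ M v v))
    ≈⟨ +-cong (+-cong (det-rows₀₁-equal (withRows₀₁ M u u) (λ s → refl)) (det-cong {M = withRows₀₁ M u v} unchanged))
              (+-congˡ (det-rows₀₁-equal (withRows₀₁ M v v) (λ s → refl))) ⟩
      (0# + det M) + (det (withRows₀₁ M v u) + 0#)
    ≈⟨ +-cong (+-identityˡ _) (+-identityʳ _) ⟩
      det M + det (withRows₀₁ M v u) ∎))
    where
    u v w : Fin _ → Carrier
    u = M zero
    v = M (suc zero)
    w = λ s → u s + v s
    unchanged : ∀ r s → withRows₀₁ M u v r s ≈ M r s
    unchanged zero          s = refl
    unchanged (suc zero)    s = refl
    unchanged (suc (suc r)) s = refl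

  consRow : ∀ {n} {A : Set c} → A → (Fin n → A) → Fin (suc n) → A
  consRow a f zero    = a
  consRow a f (suc r) = f r

  raiseRow : ∀ {n} {A : Set c} → Fin (suc n) → (Fin (suc n) → A) → Fin (suc n) → A
  raiseRow i M zero    = M i
  raiseRow i M (suc r) = M (punchIn i r)

  det-raiseRow : ∀ {n} (i : Fin (suc n)) (M : Matrix (suc n)) → det (raiseRow i M) ≈ sgn (toℕ i) * det M
  det-raiseRow zero M = trans (det-cong same) (sym (*-identityˡ _))
    where
    same : ∀ r s → raiseRow zero M r s ≈ M r s
    same zero    s = refl
    same (suc r) s = refl
  det-raiseRow {suc n} (suc i) M = begin
      det (raiseRow (suc i) M)
    ≈⟨ det-cong swapped ⟩
      det (withRows₀₁ M′ (M′ (suc zero)) (M′ zero))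
    ≈⟨ det-swap₀₁ M′ ⟩
      - det M′
    ≈⟨ -‿cong (sumF-cong {f = expansionTerm M′} (λ j → *-congˡ (*-congˡ
         (trans (det-cong (raised j)) (det-raiseRow i (minor zero j M)))))) ⟩
      - sumF (λ j → sgn (toℕ j) * (M zero j * (sgn (toℕ i) * det (minor zero j M))))
    ≈⟨ -‿cong (sumF-cong (λ j → rotate (sgn (toℕ j)) (M zero j) (sgn (toℕ i)) (det (minor zero j M)))) ⟩
      - sumF (λ j → sgn (toℕ i) * expansionTerm M j)
    ≈⟨ -‿cong (sumF-* (sgn (toℕ i)) (expansionTerm M)) ⟩
      - (sgn (toℕ i) * det M)
    ≈⟨ -‿distribˡ-* _ _ ⟩
      (- sgn (toℕ i)) * det M ∎
    where
    M′ : Matrix (suc (suc n))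
    M′ = consRow (M zero) (raiseRow i (λ r → M (suc r)))
    swapped : ∀ r s → raiseRow (suc i) M r s ≈ withRows₀₁ M′ (M′ (suc zero)) (M′ zero) r s
    swapped zero          s = refl
    swapped (suc zero)    s = refl
    swapped (suc (suc r)) s = refl
    raised : ∀ j r s → minor zero j M′ r s ≈ raiseRow i (minor zero j M) r s
    raised j zero    s = refl
    raised j (suc r) s = refl
    rotate : ∀ s m t d → s * (m * (t * d)) ≈ t * (s * (m * d))
    rotate = solve 4 (λ s m t d → s :* (m :* (t :* d)) := t :* (s :* (m :* d))) refl

  det-via-raiseRow : ∀ {n} (i : Fin (suc n)) (M : Matrix (suc n)) → det M ≈ sgn (toℕ i) * det (raiseRow i M)
  det-via-raiseRow i M = sym (begin
    sgn (toℕ i) * det (raiseRow i M)    ≈⟨ *-congˡ (det-raiseRow i M) ⟩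
    sgn (toℕ i) * (sgn (toℕ i) * det M) ≈⟨ *-assoc _ _ _ ⟨
    (sgn (toℕ i) * sgn (toℕ i)) * det M ≈⟨ *-congʳ (sgn-square (toℕ i)) ⟩
    1# * det M                          ≈⟨ *-identityˡ _ ⟩
    det M                               ∎)

  private
    term-zero : ∀ s m d → m ≈ 0# ⊎ d ≈ 0# → s * (m * d) ≈ 0#
    term-zero s m d (inj₁ m≈0) = trans (*-congˡ (trans (*-congʳ m≈0) (zeroˡ d))) (zeroʳ s)
    term-zero s m d (inj₂ d≈0) = trans (*-congˡ (trans (*-congˡ d≈0) (zeroʳ m))) (zeroʳ s)

  det-zero-column : ∀ {n} (M : Matrix n) (k : Fin n) → (∀ r → M r k ≈ 0#) → det M ≈ 0#
  det-zero-column {suc n} M k col≈0 = sumF-zero {f = expansionTerm M} term≈0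
    where
    term≈0 : ∀ j → expansionTerm M j ≈ 0#
    term≈0 j with j Fin.≟ k
    ... | yes ≡.refl = term-zero _ _ _ (inj₁ (col≈0 zero))
    ... | no j≢k     = term-zero _ _ _ (inj₂ (det-zero-column (minor zero j M) (punchOut j≢k)
                         (λ r → trans (reflexive (≡.cong (M (suc r)) (FinP.punchIn-punchOut j≢k))) (col≈0 (suc r)))))

  det-column-singleton : ∀ {n} (M : Matrix (suc n)) (i k : Fin (suc n)) → (∀ r → r ≢ i → M r k ≈ 0#) →
    det M ≈ sgn (toℕ i) * (sgn (toℕ k) * (M i k * det (minor i k M)))
  det-column-singleton M i k col≈0 = trans (det-via-raiseRow i M) (*-congˡ (sumF-single (expansionTerm (raiseRow i M)) k term≈0))
    where
    term≈0 : ∀ j → j ≢ k → expansionTerm (raiseRow i M) j ≈ 0#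
    term≈0 j j≢k = term-zero _ _ _ (inj₂ (det-zero-column (minor zero j (raiseRow i M)) (punchOut j≢k)
      (λ r → trans (reflexive (≡.cong (M (punchIn i r)) (FinP.punchIn-punchOut j≢k)))
                   (col≈0 (punchIn i r) (FinP.punchInᵢ≢i i r)))))

  det-row-singleton : ∀ {n} (M : Matrix (suc n)) (i k : Fin (suc n)) → (∀ j → j ≢ k → M i j ≈ 0#) →
    det M ≈ sgn (toℕ i) * (sgn (toℕ k) * (M i k * det (minor i k M)))
  det-row-singleton M i k row≈0 = trans (det-via-raiseRow i M)
    (*-congˡ (sumF-single (expansionTerm (raiseRow i M)) k (λ j j≢k → term-zero _ _ _ (inj₁ (row≈0 j j≢k)))))

  det-zero-row : ∀ {n} (M : Matrix (suc n)) (i : Fin (suc n)) → (∀ s → M i s ≈ 0#) → det M ≈ 0#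
  det-zero-row M i row≈0 = trans (det-row-singleton M i zero (λ j _ → row≈0 j))
    (trans (*-congˡ (term-zero _ _ _ (inj₁ (row≈0 zero)))) (zeroʳ _))

  private
    det-repeated-row₀ : ∀ {n} (M : Matrix (suc n)) (k : Fin n) → (∀ s → M zero s ≈ M (suc k) s) → det M ≈ 0#
    det-repeated-row₀ {suc n} M k rows≈ = trans (det-via-raiseRow (suc k) M)
      (trans (*-congˡ (det-rows₀₁-equal (raiseRow (suc k) M) (λ s → sym (rows≈ s)))) (zeroʳ _))

  det-equal-rows : ∀ {n} (M : Matrix n) (i k : Fin n) → i ≢ k → (∀ s → M i s ≈ M k s) → det M ≈ 0#
  det-equal-rows {suc n} M i k i≢k rows≈ = trans (det-via-raiseRow i M) (trans (*-congˡ
    (det-repeated-row₀ (raiseRow i M) (punchOut i≢k)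
      (λ s → trans (rows≈ s) (reflexive (≡.cong (λ t → M t s) (≡.sym (FinP.punchIn-punchOut i≢k)))))))
    (zeroʳ _))

  replaceRow : ∀ {n} → Matrix n → Fin n → (Fin n → Carrier) → Matrix n
  replaceRow M i v r with r Fin.≟ i
  ... | yes _ = v
  ... | no  _ = M r

  replaceRow-≡ : ∀ {n} (M : Matrix n) i v s → replaceRow M i v i s ≈ v s
  replaceRow-≡ M i v s with i Fin.≟ i
  ... | yes _ = refl
  ... | no i≢i = ⊥-elim (i≢i ≡.refl)

  replaceRow-≢ : ∀ {n} (M : Matrix n) i v r s → r ≢ i → replaceRow M i v r s ≈ M r s
  replaceRow-≢ M i v r s r≢i with r Fin.≟ i
  ... | yes r≡i = ⊥-elim (r≢i r≡i)
  ... | no  _   = refl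

  det-add-row-multiple : ∀ {n} (M P : Matrix n) (i k : Fin n) (a : Carrier) → i ≢ k →
    (∀ r → r ≢ i → ∀ s → P r s ≈ M r s) → (∀ s → P i s ≈ M i s + a * M k s) → det P ≈ det M
  det-add-row-multiple M P i k a i≢k others row = begin
    det P                                ≈⟨ det-linear-row i a M Mₖ P others′ row′ ⟩
    det M + a * det Mₖ                   ≈⟨ +-congˡ (*-congˡ (det-equal-rows Mₖ i k i≢k rows≈)) ⟩
    det M + a * 0#                       ≈⟨ +-congˡ (zeroʳ a) ⟩
    det M + 0#                           ≈⟨ +-identityʳ _ ⟩
    det M                                ∎
    where
    Mₖ : Matrix _
    Mₖ = replaceRow M i (M k)
    others′ : ∀ r → r ≢ i → ∀ s → (P r s ≈ M r s) × (P r s ≈ Mₖ r s)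
    others′ r r≢i s = others r r≢i s , trans (others r r≢i s) (sym (replaceRow-≢ M i (M k) r s r≢i))
    row′ : ∀ s → P i s ≈ M i s + a * Mₖ i s
    row′ s = trans (row s) (+-congˡ (*-congˡ (sym (replaceRow-≡ M i (M k) s))))
    rows≈ : ∀ s → Mₖ i s ≈ Mₖ k s
    rows≈ s = trans (replaceRow-≡ M i (M k) s) (sym (replaceRow-≢ M i (M k) k s (i≢k ∘ ≡.sym)))

  det-linear-combination-row : ∀ {n} (i : Fin (suc n)) (a b : Carrier) (M N P : Matrix (suc n)) →
    (∀ r → r ≢ i → ∀ s → (P r s ≈ M r s) × (P r s ≈ N r s)) →
    (∀ s → P i s ≈ b * M i s + a * N i s) → det P ≈ b * det M + a * det N
  det-linear-combination-row i a b M N P others row =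
    trans (det-linear-row i a bM N P others′ (λ s → trans (row s) (+-congʳ (sym (replaceRow-≡ M i _ s)))))
          (+-congʳ det-bM)
    where
    bM Z : Matrix _
    bM = replaceRow M i (λ s → b * M i s)
    Z  = replaceRow M i (λ s → 0#)
    others′ : ∀ r → r ≢ i → ∀ s → (P r s ≈ bM r s) × (P r s ≈ N r s)
    others′ r r≢i s = trans (proj₁ (others r r≢i s)) (sym (replaceRow-≢ M i _ r s r≢i)) , proj₂ (others r r≢i s)
    det-bM : det bM ≈ b * det M
    det-bM = trans (det-linear-row i b Z M bM
                      (λ r r≢i s → trans (replaceRow-≢ M i _ r s r≢i) (sym (replaceRow-≢ M i _ r s r≢i))
                                 , replaceRow-≢ M i _ r s r≢i)
                      (λ s → trans (replaceRow-≡ M i _ s) (sym (trans (+-congʳ (replaceRow-≡ M i _ s)) (+-identityˡ _)))))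
                   (trans (+-congʳ (det-zero-row Z i (λ s → replaceRow-≡ M i _ s))) (+-identityˡ _))

  nextRow : ∀ {m k} → (Fin (suc m) → Fin k → Carrier) → Fin (suc m) → Fin k → Carrier
  nextRow {zero}  F zero    s = 0#
  nextRow {suc m} F zero    s = F (suc zero) s
  nextRow {suc m} F (suc r) s = nextRow (λ r → F (suc r)) r s

  rowDifferences : ∀ {m k} → (Fin (suc m) → Fin k → Carrier) → Fin (suc m) → Fin k → Carrier
  rowDifferences F r s = F r s - nextRow F r s

  nextRow-columns : ∀ {m k k′} (F : Fin (suc m) → Fin k → Carrier) (g : Fin k′ → Fin k) r s →
    nextRow F r (g s) ≡ nextRow (λ r s → F r (g s)) r s
  nextRow-columns {zero}  F g zero    s = ≡.refl
  nextRow-columns {suc m} F g zero    s = ≡.refl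
  nextRow-columns {suc m} F g (suc r) s = nextRow-columns (λ r → F (suc r)) g r s

  -- Row r+1 is still unchanged when it is subtracted from row r, so each step is an elementary row operation.
  mutual
    det-rowDifferences : ∀ {n} (M : Matrix (suc n)) → det (rowDifferences M) ≈ det M
    det-rowDifferences {zero} M = det-cong last
      where
      last : ∀ r s → rowDifferences M r s ≈ M r s
      last zero s = trans (+-congˡ -0#≈0#) (+-identityʳ _)
    det-rowDifferences {suc n} M = begin
        det (rowDifferences M)
      ≈⟨ det-cong {N = consRow (M′ zero) (rowDifferences (λ r → M′ (suc r)))} same ⟩
        det (consRow (M′ zero) (rowDifferences (λ r → M′ (suc r))))
      ≈⟨ det-rowDifferences-tail M′ ⟩
        det M′
      ≈⟨ det-add-row-multiple M M′ zero (suc zero) (- 1#) (λ ()) others row₀ ⟩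
        det M ∎
      where
      M′ : Matrix (suc (suc n))
      M′ = consRow (λ s → M zero s - M (suc zero) s) (λ r → M (suc r))
      same : ∀ r s → rowDifferences M r s ≈ consRow (M′ zero) (rowDifferences (λ r → M′ (suc r))) r s
      same zero    s = refl
      same (suc r) s = refl
      others : ∀ r → r ≢ zero → ∀ s → M′ r s ≈ M r s
      others zero    r≢0 s = ⊥-elim (r≢0 ≡.refl)
      others (suc r) r≢0 s = refl
      row₀ : ∀ s → M′ zero s ≈ M zero s + (- 1#) * M (suc zero) s
      row₀ s = +-congˡ (sym (-1*x≈-x _))

    det-rowDifferences-tail : ∀ {n} (M : Matrix (suc (suc n))) →
      det (consRow (M zero) (rowDifferences (λ r → M (suc r)))) ≈ det M
    det-rowDifferences-tail {n} M = sumF-cong {g = expansionTerm M} (λ j → *-congˡ (*-congˡ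
        (trans (det-cong {N = rowDifferences (minor zero j M)}
                  (λ r s → reflexive (≡.cong (λ t → M (suc r) (punchIn j s) - t)
                                             (nextRow-columns (λ r → M (suc r)) (punchIn j) r s))))
               (det-rowDifferences (minor zero j M)))))

  tabulateℕ : ∀ {m} → (ℕ → ℕ → Carrier) → Matrix m
  tabulateℕ f r s = f (toℕ r) (toℕ s)

  det-tabulateℕ-cong : ∀ m {f g : ℕ → ℕ → Carrier} → (∀ a b → a ℕ.< m → b ℕ.< m → f a b ≈ g a b) →
    det (tabulateℕ {m} f) ≈ det (tabulateℕ {m} g)
  det-tabulateℕ-cong m f≈g = det-cong (λ r s → f≈g (toℕ r) (toℕ s) (FinP.toℕ<n r) (FinP.toℕ<n s))

  private
    sgn-twice : ∀ k d → sgn k * (sgn k * (1# * d)) ≈ d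
    sgn-twice k d = begin
      sgn k * (sgn k * (1# * d)) ≈⟨ *-assoc _ _ _ ⟨
      (sgn k * sgn k) * (1# * d) ≈⟨ *-cong (sgn-square k) (*-identityˡ d) ⟩
      1# * d                     ≈⟨ *-identityˡ d ⟩
      d                          ∎

  det-last-row-unit : ∀ k (f : ℕ → ℕ → Carrier) → (∀ b → b ℕ.< k → f k b ≈ 0#) → f k k ≈ 1# →
    det (tabulateℕ {suc k} f) ≈ det (tabulateℕ {k} f)
  det-last-row-unit k f row≈0 corner≈1 = begin
      det (tabulateℕ {suc k} f)
    ≈⟨ det-row-singleton (tabulateℕ f) last last row≈0′ ⟩
      sgn (toℕ last) * (sgn (toℕ last) * (f (toℕ last) (toℕ last) * det (minor last last (tabulateℕ f))))
    ≡⟨ ≡.cong (λ t → sgn t * (sgn t * (f t t * det (minor last last (tabulateℕ f))))) (FinP.toℕ-fromℕ k) ⟩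
      sgn k * (sgn k * (f k k * det (minor last last (tabulateℕ f))))
    ≈⟨ *-congˡ (*-congˡ (*-cong corner≈1 (det-cong {N = tabulateℕ {k} f}
         (λ r s → reflexive (≡.cong₂ f (toℕ-punchIn-last r) (toℕ-punchIn-last s)))))) ⟩
      sgn k * (sgn k * (1# * det (tabulateℕ {k} f)))
    ≈⟨ sgn-twice k _ ⟩
      det (tabulateℕ {k} f) ∎
    where
    last = Fin.fromℕ k
    row≈0′ : ∀ j → j ≢ last → tabulateℕ {suc k} f last j ≈ 0#
    row≈0′ j j≢last = trans (reflexive (≡.cong (λ t → f t (toℕ j)) (FinP.toℕ-fromℕ k)))
      (row≈0 (toℕ j) (ℕP.≤∧≢⇒< (ℕP.≤-pred (FinP.toℕ<n j))
                                 (λ e → j≢last (FinP.toℕ-injective (≡.trans e (≡.sym (FinP.toℕ-fromℕ k)))))))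

  det-last-column-top : ∀ k (f : ℕ → ℕ → Carrier) → (∀ a → a ℕ.< k → f (suc a) k ≈ 0#) →
    det (tabulateℕ {suc k} f) ≈ sgn k * (f 0 k * det (tabulateℕ {k} (λ a b → f (suc a) b)))
  det-last-column-top k f col≈0 = begin
      det (tabulateℕ {suc k} f)
    ≈⟨ det-column-singleton (tabulateℕ f) zero last col≈0′ ⟩
      1# * (sgn (toℕ last) * (f 0 (toℕ last) * det (minor zero last (tabulateℕ f))))
    ≈⟨ *-identityˡ _ ⟩
      sgn (toℕ last) * (f 0 (toℕ last) * det (minor zero last (tabulateℕ f)))
    ≡⟨ ≡.cong (λ t → sgn t * (f 0 t * det (minor zero last (tabulateℕ f)))) (FinP.toℕ-fromℕ k) ⟩
      sgn k * (f 0 k * det (minor zero last (tabulateℕ f)))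
    ≈⟨ *-congˡ (*-congˡ (det-cong {N = tabulateℕ {k} (λ a b → f (suc a) b)}
         (λ r s → reflexive (≡.cong (f (suc (toℕ r))) (toℕ-punchIn-last s))))) ⟩
      sgn k * (f 0 k * det (tabulateℕ {k} (λ a b → f (suc a) b))) ∎
    where
    last = Fin.fromℕ k
    col≈0′ : ∀ r → r ≢ zero → tabulateℕ {suc k} f r last ≈ 0#
    col≈0′ zero    r≢0 = ⊥-elim (r≢0 ≡.refl)
    col≈0′ (suc r) r≢0 = trans (reflexive (≡.cong (f (suc (toℕ r))) (FinP.toℕ-fromℕ k))) (col≈0 (toℕ r) (FinP.toℕ<n r))

  det-first-row-unit : ∀ k (f : ℕ → ℕ → Carrier) → (∀ b → f 0 (suc b) ≈ 0#) → f 0 0 ≈ 1# →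
    det (tabulateℕ {suc k} f) ≈ det (tabulateℕ {k} (λ a b → f (suc a) (suc b)))
  det-first-row-unit k f row≈0 corner≈1 = trans (det-row-singleton (tabulateℕ {suc k} f) zero zero row≈0′)
    (trans (*-identityˡ _) (trans (*-identityˡ _) (trans (*-congʳ corner≈1) (*-identityˡ _))))
    where
    row≈0′ : ∀ j → j ≢ zero → tabulateℕ {suc k} f zero j ≈ 0#
    row≈0′ zero    j≢0 = ⊥-elim (j≢0 ≡.refl)
    row≈0′ (suc j) j≢0 = row≈0 (toℕ j)

  det-second-row-unit : ∀ k (f : ℕ → ℕ → Carrier) → (∀ b → f 1 (suc b) ≈ 0#) → f 1 0 ≈ 1# →
    det (tabulateℕ {suc (suc k)} f) ≈ - det (tabulateℕ {suc k} (λ a b → f (punchInℕ 1 a) (suc b)))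
  det-second-row-unit k f row≈0 corner≈1 = begin
      det (tabulateℕ {suc (suc k)} f)
    ≈⟨ det-row-singleton (tabulateℕ f) (suc zero) zero row≈0′ ⟩
      - 1# * (1# * (f 1 0 * det (minor (suc zero) zero (tabulateℕ {suc (suc k)} f))))
    ≈⟨ *-congˡ (trans (*-identityˡ _) (trans (*-cong corner≈1 (det-cong {N = tabulateℕ {suc k} f′} same)) (*-identityˡ _))) ⟩
      - 1# * det (tabulateℕ {suc k} (λ a b → f (punchInℕ 1 a) (suc b)))
    ≈⟨ -1*x≈-x _ ⟩
      - det (tabulateℕ {suc k} (λ a b → f (punchInℕ 1 a) (suc b))) ∎
    where
    row≈0′ : ∀ j → j ≢ zero → tabulateℕ {suc (suc k)} f (suc zero) j ≈ 0#
    row≈0′ zero    j≢0 = ⊥-elim (j≢0 ≡.refl)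
    row≈0′ (suc j) j≢0 = row≈0 (toℕ j)
    f′ : ℕ → ℕ → Carrier
    f′ a b = f (punchInℕ 1 a) (suc b)
    same : ∀ r s → minor (suc zero) zero (tabulateℕ {suc (suc k)} f) r s ≈ tabulateℕ {suc k} f′ r s
    same zero    s = refl
    same (suc r) s = refl

  nextRow-tabulateℕ : ∀ {m k} (f : ℕ → ℕ → Carrier) → (∀ (s : Fin k) → f (suc m) (toℕ s) ≈ 0#) →
    ∀ r s → nextRow {m} {k} (λ r s → f (toℕ r) (toℕ s)) r s ≈ f (suc (toℕ r)) (toℕ s)
  nextRow-tabulateℕ {zero}  f last≈0 zero    s = sym (last≈0 s)
  nextRow-tabulateℕ {suc m} f last≈0 zero    s = refl
  nextRow-tabulateℕ {suc m} f last≈0 (suc r) s = nextRow-tabulateℕ {m} (λ a b → f (suc a) b) last≈0 r s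

  det-1×1 : ∀ (M : Matrix 1) → det M ≈ M zero zero
  det-1×1 M = trans (+-identityʳ _) (trans (*-identityˡ _) (*-identityʳ _))

  det-2×2 : ∀ (M : Matrix 2) → det M ≈ M zero zero * M (suc zero) (suc zero) - M zero (suc zero) * M (suc zero) zero
  det-2×2 M = expand (M zero zero) (M zero (suc zero)) (M (suc zero) zero) (M (suc zero) (suc zero))
    where
    expand : ∀ a b c d → 1# * (a * (1# * (d * 1#) + 0#)) + ((- 1#) * (b * (1# * (c * 1#) + 0#)) + 0#) ≈ a * d - b * c
    expand = solve 4 (λ a b c d → con (+ 1) :* (a :* (con (+ 1) :* (d :* con (+ 1)) :+ con (+ 0)))
                                  :+ ((:- con (+ 1)) :* (b :* (con (+ 1) :* (c :* con (+ 1)) :+ con (+ 0))) :+ con (+ 0))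
                                  := a :* d :- b :* c) refl

  -- G is F with c times row 0 added to its last row, chosen so that column 0 of G is e₀.
  det-clear-column₀ : ∀ m (F G : ℕ → ℕ → Carrier) (c : Carrier) →
    (∀ a b → a ≢ suc m → G a b ≈ F a b) →
    (∀ b → b ℕ.< suc (suc m) → G (suc m) b ≈ F (suc m) b + c * F 0 b) →
    (∀ a → a ℕ.≤ m → G (suc a) 0 ≈ 0#) → G 0 0 ≈ 1# →
    det (tabulateℕ {suc (suc m)} F) ≈ det (tabulateℕ {suc m} (λ a b → G (suc a) (suc b)))
  det-clear-column₀ m F G c others last column₀≈0 corner≈1 = begin
      det (tabulateℕ {suc (suc m)} F)
    ≈⟨ det-add-row-multiple (tabulateℕ F) (tabulateℕ G) iₗ zero c (λ ()) others′ last′ ⟨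
      det (tabulateℕ {suc (suc m)} G)
    ≈⟨ det-column-singleton (tabulateℕ G) zero zero column₀≈0′ ⟩
      1# * (1# * (G 0 0 * det (tabulateℕ {suc m} (λ a b → G (suc a) (suc b)))))
    ≈⟨ trans (*-identityˡ _) (trans (*-identityˡ _) (trans (*-congʳ corner≈1) (*-identityˡ _))) ⟩
      det (tabulateℕ {suc m} (λ a b → G (suc a) (suc b))) ∎
    where
    iₗ : Fin (suc (suc m))
    iₗ = Fin.fromℕ (suc m)
    others′ : ∀ r → r ≢ iₗ → ∀ s → tabulateℕ G r s ≈ tabulateℕ F r s
    others′ r r≢iₗ s = others (toℕ r) (toℕ s)
      (λ e → r≢iₗ (FinP.toℕ-injective (≡.trans e (≡.sym (FinP.toℕ-fromℕ (suc m))))))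
    last′ : ∀ s → tabulateℕ G iₗ s ≈ tabulateℕ F iₗ s + c * tabulateℕ F zero s
    last′ s = ≡.subst (λ a → G a (toℕ s) ≈ F a (toℕ s) + c * F 0 (toℕ s)) (≡.sym (FinP.toℕ-fromℕ (suc m)))
                      (last (toℕ s) (FinP.toℕ<n s))
    column₀≈0′ : ∀ r → r ≢ zero → tabulateℕ {suc (suc m)} G r zero ≈ 0#
    column₀≈0′ zero    r≢0 = ⊥-elim (r≢0 ≡.refl)
    column₀≈0′ (suc r) r≢0 = column₀≈0 (toℕ r) (ℕP.≤-pred (FinP.toℕ<n r))

module Polynomial {c ℓ : Level} (R : CommutativeRing c ℓ) where
  open CommutativeRing R hiding (zero)
  open WithRing R
  open IntegerCoefficients R using (solve; _:+_; _:*_; _:-_; :-_; _:=_; con)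
  open Determinant R using (sgn-+)
  open import Relation.Binary.Reasoning.Setoid setoid
  open import Data.Fin using (toℕ)
  open import Data.Nat.DivMod using (_/_)
  open import Data.Nat.Combinatorics using (_C_)
  import Data.Nat.Combinatorics as ℕC
  open import Data.Integer using (+_)
  open IndexArithmetic using (⌊3[k+2]/2⌋≡⌊3k/2⌋+3)

  fromℕ-+ : ∀ m n → fromℕ (m ℕ.+ n) ≈ fromℕ m + fromℕ n
  fromℕ-+ zero    n = sym (+-identityˡ _)
  fromℕ-+ (suc m) n = trans (+-congˡ (fromℕ-+ m n)) (sym (+-assoc _ _ _))

  pow-cong : ∀ {y z} → y ≈ z → ∀ k → pow y k ≈ pow z k
  pow-cong y≈z zero    = refl
  pow-cong y≈z (suc k) = *-cong y≈z (pow-cong y≈z k)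

  pow-neg : ∀ y k → pow (- y) k ≈ sgn k * pow y k
  pow-neg y zero    = sym (*-identityˡ 1#)
  pow-neg y (suc k) = trans (*-congˡ (pow-neg y k)) (reorder (sgn k) y (pow y k))
    where
    reorder : ∀ s y p → (- y) * (s * p) ≈ (- s) * (y * p)
    reorder = solve 3 (λ s y p → (:- y) :* (s :* p) := (:- s) :* (y :* p)) refl

  sumTo : (ℕ → Carrier) → ℕ → Carrier
  sumTo f zero    = 0#
  sumTo f (suc m) = f 0 + sumTo (λ k → f (suc k)) m

  sumF-sumTo : ∀ m (f : ℕ → Carrier) → sumF {m} (λ k → f (toℕ k)) ≈ sumTo f m
  sumF-sumTo zero    f = refl
  sumF-sumTo (suc m) f = +-congˡ (sumF-sumTo m (λ k → f (suc k)))

  sumTo-cong : ∀ m {f g : ℕ → Carrier} → (∀ k → f k ≈ g k) → sumTo f m ≈ sumTo g m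
  sumTo-cong zero    f≈g = refl
  sumTo-cong (suc m) f≈g = +-cong (f≈g 0) (sumTo-cong m (λ k → f≈g (suc k)))

  sumTo-+ : ∀ m (f g : ℕ → Carrier) → sumTo (λ k → f k + g k) m ≈ sumTo f m + sumTo g m
  sumTo-+ zero    f g = sym (+-identityʳ 0#)
  sumTo-+ (suc m) f g = trans (+-congˡ (sumTo-+ m (λ k → f (suc k)) (λ k → g (suc k)))) (interchange _ _ _ _)
    where
    interchange : ∀ a b c d → (a + b) + (c + d) ≈ (a + c) + (b + d)
    interchange = solve 4 (λ a b c d → (a :+ b) :+ (c :+ d) := (a :+ c) :+ (b :+ d)) refl

  sumTo-* : ∀ m (a : Carrier) (f : ℕ → Carrier) → sumTo (λ k → a * f k) m ≈ a * sumTo f m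
  sumTo-* zero    a f = sym (zeroʳ a)
  sumTo-* (suc m) a f = trans (+-congˡ (sumTo-* m a (λ k → f (suc k)))) (sym (distribˡ a _ _))

  sumTo-snoc : ∀ m (f : ℕ → Carrier) → sumTo f (suc m) ≈ sumTo f m + f m
  sumTo-snoc zero    f = trans (+-identityʳ _) (sym (+-identityˡ _))
  sumTo-snoc (suc m) f = trans (+-congˡ (sumTo-snoc m (λ k → f (suc k)))) (sym (+-assoc _ _ _))

  term : ℕ → Carrier → ℕ → Carrier
  term n y k = sgn ((3 ℕ.* k) / 2) * (fromℕ (((n ℕ.+ k) / 2) C k) * pow y k)

  P≈sumTo : ∀ n y → P n y ≈ sumTo (term n y) (suc n)
  P≈sumTo n y = sumF-sumTo (suc n) (term n y)

  term-0 : ∀ n y → term n y 0 ≈ 1#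
  term-0 n y = trans (*-identityˡ _) (trans (*-identityʳ _) (+-identityʳ 1#))

  term-vanishes : ∀ n y k → n ℕ.< k → term n y k ≈ 0#
  term-vanishes n y k n<k =
    trans (*-congˡ (trans (*-congʳ (reflexive (≡.cong fromℕ (ℕC.k>n⇒nCk≡0 ⌊[n+k]/2⌋<k)))) (zeroˡ _))) (zeroʳ _)
    where
    ⌊[n+k]/2⌋<k : (n ℕ.+ k) / 2 ℕ.< k
    ⌊[n+k]/2⌋<k = ℕDM.m<n*o⇒m/o<n (≡.subst (n ℕ.+ k ℕ.<_) (ℕP.*-comm 2 k)
      (≡.subst (λ t → n ℕ.+ k ℕ.< k ℕ.+ t) (≡.sym (ℕP.+-identityʳ k)) (ℕP.+-monoˡ-< k n<k)))


  private
    sgn-+3 : ∀ a → sgn (a ℕ.+ 3) ≈ - sgn a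
    sgn-+3 a = trans (sgn-+ a 3) (s*---1≈-s (sgn a))
      where
      s*---1≈-s : ∀ s → s * (- (- (- 1#))) ≈ - s
      s*---1≈-s = solve 1 (λ s → s :* (:- (:- (:- con (+ 1)))) := :- s) refl

  sgn-⌊3[k+1]/2⌋ : ∀ k → sgn ((3 ℕ.* suc k) / 2) ≈ - (sgn ((3 ℕ.* k) / 2) * sgn k)
  sgn-⌊3[k+1]/2⌋ zero          = sym (-‿cong (*-identityˡ 1#))
  sgn-⌊3[k+1]/2⌋ (suc zero)    = solve 0 (:- (:- (:- con (+ 1))) := :- ((:- con (+ 1)) :* (:- con (+ 1)))) refl
  sgn-⌊3[k+1]/2⌋ (suc (suc k)) = begin
      sgn ((3 ℕ.* suc (suc (suc k))) / 2)
    ≡⟨ ≡.cong sgn (⌊3[k+2]/2⌋≡⌊3k/2⌋+3 (suc k)) ⟩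
      sgn ((3 ℕ.* suc k) / 2 ℕ.+ 3)
    ≈⟨ sgn-+3 ((3 ℕ.* suc k) / 2) ⟩
      - sgn ((3 ℕ.* suc k) / 2)
    ≈⟨ -‿cong (sgn-⌊3[k+1]/2⌋ k) ⟩
      - (- (sgn ((3 ℕ.* k) / 2) * sgn k))
    ≈⟨ regroup (sgn ((3 ℕ.* k) / 2)) (sgn k) ⟩
      - ((- sgn ((3 ℕ.* k) / 2)) * (- (- sgn k)))
    ≈⟨ -‿cong (*-congʳ (sgn-+3 ((3 ℕ.* k) / 2))) ⟨
      - (sgn ((3 ℕ.* k) / 2 ℕ.+ 3) * (- (- sgn k)))
    ≡⟨ ≡.cong (λ t → - (sgn t * (- (- sgn k)))) (⌊3[k+2]/2⌋≡⌊3k/2⌋+3 k) ⟨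
      - (sgn ((3 ℕ.* suc (suc k)) / 2) * sgn (suc (suc k))) ∎
    where
    regroup : ∀ a b → - (- (a * b)) ≈ - ((- a) * (- (- b)))
    regroup = solve 2 (λ a b → :- (:- (a :* b)) := :- ((:- a) :* (:- (:- b)))) refl

  -- Pascal's rule for the binomial coefficient, together with the sign pattern of ⌊3k/2⌋.
  term-step : ∀ n y k → term (suc (suc n)) y (suc k) ≈ term n y (suc k) + (- y) * term (suc n) (- y) k
  term-step n y k = begin
      sgn ((3 ℕ.* suc k) / 2) * (fromℕ ((suc (suc (n ℕ.+ suc k)) / 2) C suc k) * (y * pow y k))
    ≡⟨ ≡.cong (λ t → sgn ((3 ℕ.* suc k) / 2) * (fromℕ t * (y * pow y k))) pascal ⟩
      sgn ((3 ℕ.* suc k) / 2) * (fromℕ (t C k ℕ.+ t C suc k) * (y * pow y k))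
    ≈⟨ *-cong (sgn-⌊3[k+1]/2⌋ k) (*-congʳ (fromℕ-+ (t C k) (t C suc k))) ⟩
      (- (sgn ((3 ℕ.* k) / 2) * sgn k)) * ((fromℕ (t C k) + fromℕ (t C suc k)) * (y * pow y k))
    ≈⟨ split (sgn ((3 ℕ.* k) / 2)) (sgn k) (fromℕ (t C k)) (fromℕ (t C suc k)) y (pow y k) ⟩
      (- (sgn ((3 ℕ.* k) / 2) * sgn k)) * (fromℕ (t C suc k) * (y * pow y k))
        + (- y) * (sgn ((3 ℕ.* k) / 2) * (fromℕ (t C k) * (sgn k * pow y k)))
    ≈⟨ +-cong (*-congʳ (sym (sgn-⌊3[k+1]/2⌋ k)))
              (*-congˡ (*-congˡ (*-cong (reflexive (≡.cong (λ u → fromℕ ((u / 2) C k)) (ℕP.+-suc n k)))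
                                         (sym (pow-neg y k))))) ⟩
      term n y (suc k) + (- y) * term (suc n) (- y) k ∎
    where
    t : ℕ
    t = (n ℕ.+ suc k) / 2
    pascal : (suc (suc (n ℕ.+ suc k)) / 2) C suc k ≡ t C k ℕ.+ t C suc k
    pascal = ≡.trans (≡.cong (_C suc k) (ℕDM.m/n≡1+[m∸n]/n {m = suc (suc (n ℕ.+ suc k))} (s≤s (s≤s z≤n))))
                     (≡.sym (ℕC.nCk+nC[k+1]≡[n+1]C[k+1] t k))
    split : ∀ a s c₁ c₂ y p →
      (- (a * s)) * ((c₁ + c₂) * (y * p)) ≈ (- (a * s)) * (c₂ * (y * p)) + (- y) * (a * (c₁ * (s * p)))
    split = solve 6 (λ a s c₁ c₂ y p → (:- (a :* s)) :* ((c₁ :+ c₂) :* (y :* p))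
                                       := (:- (a :* s)) :* (c₂ :* (y :* p)) :+ (:- y) :* (a :* (c₁ :* (s :* p)))) refl

  -- Term by term, using term-step; the two extra terms of P n y beyond degree n vanish.
  P-recurrence : ∀ n y → P (suc (suc n)) y ≈ P n y + (- y) * P (suc n) (- y)
  P-recurrence n y = begin
      P (suc (suc n)) y
    ≈⟨ P≈sumTo (suc (suc n)) y ⟩
      term (suc (suc n)) y 0 + sumTo (λ k → term (suc (suc n)) y (suc k)) (suc (suc n))
    ≈⟨ +-cong (term-0 (suc (suc n)) y) (sumTo-cong (suc (suc n)) (term-step n y)) ⟩
      1# + sumTo (λ k → g k + (- y) * term (suc n) (- y) k) (suc (suc n))
    ≈⟨ +-congˡ (trans (sumTo-+ (suc (suc n)) g (λ k → (- y) * term (suc n) (- y) k))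
                      (+-congˡ (sumTo-* (suc (suc n)) (- y) (term (suc n) (- y))))) ⟩
      1# + (sumTo g (suc (suc n)) + (- y) * sumTo (term (suc n) (- y)) (suc (suc n)))
    ≈⟨ +-congˡ (+-cong drop-vanishing (*-congˡ (sym (P≈sumTo (suc n) (- y))))) ⟩
      1# + (sumTo g n + (- y) * P (suc n) (- y))
    ≈⟨ +-assoc _ _ _ ⟨
      (1# + sumTo g n) + (- y) * P (suc n) (- y)
    ≈⟨ +-congʳ (sym (trans (P≈sumTo n y) (+-congʳ (term-0 n y)))) ⟩
      P n y + (- y) * P (suc n) (- y) ∎
    where
    g : ℕ → Carrier
    g k = term n y (suc k)
    drop-vanishing : sumTo g (suc (suc n)) ≈ sumTo g n
    drop-vanishing = begin
      sumTo g (suc (suc n))        ≈⟨ sumTo-snoc (suc n) g ⟩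
      sumTo g (suc n) + g (suc n)  ≈⟨ +-cong (sumTo-snoc n g) (term-vanishes n y (suc (suc n)) (s≤s (ℕP.n≤1+n n))) ⟩
      (sumTo g n + g n) + 0#       ≈⟨ +-identityʳ _ ⟩
      sumTo g n + g n              ≈⟨ +-congˡ (term-vanishes n y (suc n) (ℕP.n<1+n n)) ⟩
      sumTo g n + 0#               ≈⟨ +-identityʳ _ ⟩
      sumTo g n                    ∎

  P-0 : ∀ y → P 0 y ≈ 1#
  P-0 y = solve 0 (con (+ 1) :* ((con (+ 1) :+ con (+ 0)) :* con (+ 1)) :+ con (+ 0) := con (+ 1)) refl

  P-1 : ∀ y → P 1 y ≈ 1# - y
  P-1 = solve 1 (λ y → con (+ 1) :* ((con (+ 1) :+ con (+ 0)) :* con (+ 1))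
                      :+ ((:- con (+ 1)) :* ((con (+ 1) :+ con (+ 0)) :* (y :* con (+ 1))) :+ con (+ 0))
                      := con (+ 1) :- y) refl

  P-cong : ∀ n {y z} → y ≈ z → P n y ≈ P n z
  P-cong n {y} {z} y≈z = begin
    P n y                      ≈⟨ P≈sumTo n y ⟩
    sumTo (term n y) (suc n)   ≈⟨ sumTo-cong (suc n) {term n y} (λ k → *-congˡ (*-congˡ (pow-cong y≈z k))) ⟩
    sumTo (term n z) (suc n)   ≈⟨ P≈sumTo n z ⟨
    P n z                      ∎

module IMinusxA {c ℓ : Level} (R : CommutativeRing c ℓ) (x : CommutativeRing.Carrier R) where
  open CommutativeRing R hiding (zero)
  open WithRing R
  open IntegerCoefficients R using (solve; _:+_; _:*_; _:-_; :-_; _:=_; con)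
  open Determinant R
  open Polynomial R using (P-recurrence; P-0; P-1; P-cong)
  open PunchIn
  open import Algebra.Properties.Ring ring using (-0#≈0#; -‿involutive; -1*x≈-x)
  open import Relation.Binary.Reasoning.Setoid setoid
  open import Data.Fin as Fin using (Fin; zero; suc; toℕ; punchIn)
  import Data.Fin.Properties as FinP
  open import Data.Product using (_×_; _,_; proj₁; proj₂)
  open import Data.Empty using (⊥-elim)
  open import Data.Bool using (if_then_else_)
  open import Relation.Nullary using (Dec; yes; no; does; ¬_)
  open import Data.Integer using (+_)
  open import Function using (_∘_)

  𝟙 : ∀ {p} {Q : Set p} → Dec Q → Carrier
  𝟙 d = if does d then 1# else 0#

  𝟙-yes : ∀ {p} {Q : Set p} (d : Dec Q) → Q → 𝟙 d ≈ 1#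
  𝟙-yes (yes _) _ = refl
  𝟙-yes (no ¬q) q = ⊥-elim (¬q q)

  𝟙-no : ∀ {p} {Q : Set p} (d : Dec Q) → ¬ Q → 𝟙 d ≈ 0#
  𝟙-no (yes q) ¬q = ⊥-elim (¬q q)
  𝟙-no (no _)  _  = refl

  𝟙-cong : ∀ {p q} {Q : Set p} {Q′ : Set q} → (Q → Q′) → (Q′ → Q) →
    (d : Dec Q) (d′ : Dec Q′) → 𝟙 d ≈ 𝟙 d′
  𝟙-cong to from (yes q)  d′ = sym (𝟙-yes d′ (to q))
  𝟙-cong to from (no ¬q) d′ = sym (𝟙-no d′ (¬q ∘ from))

  entry : ℕ → ℕ → ℕ → Carrier
  entry n a b = 𝟙 (a ℕ.≟ b) - x * 𝟙 (a ℕ.+ b ℕ.<? n)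

  IxA≈entry : ∀ n (i j : Fin n) → IxA x n i j ≈ entry n (toℕ i) (toℕ j)
  IxA≈entry n i j = +-congʳ (𝟙-cong (≡.cong toℕ) FinP.toℕ-injective (i Fin.≟ j) (toℕ i ℕ.≟ toℕ j))

  entry-suc : ∀ n a b → entry (suc (suc n)) (suc a) (suc b) ≈ entry n a b
  entry-suc n a b = +-congˡ (-‿cong (*-congˡ (𝟙-cong shrink grow (suc a ℕ.+ suc b ℕ.<? suc (suc n)) (a ℕ.+ b ℕ.<? n))))
    where
    shrink : suc a ℕ.+ suc b ℕ.< suc (suc n) → a ℕ.+ b ℕ.< n
    shrink lt = ℕP.≤-pred (ℕP.≤-pred (≡.subst (ℕ._< suc (suc n)) (≡.cong suc (ℕP.+-suc a b)) lt))
    grow : a ℕ.+ b ℕ.< n → suc a ℕ.+ suc b ℕ.< suc (suc n)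
    grow lt = ≡.subst (ℕ._< suc (suc n)) (≡.sym (≡.cong suc (ℕP.+-suc a b))) (s≤s (s≤s lt))

  entry-off : ∀ n a b → a ≢ b → n ℕ.≤ a ℕ.+ b → entry n a b ≈ 0#
  entry-off n a b a≢b n≤a+b =
    trans (+-cong (𝟙-no (a ℕ.≟ b) a≢b) (-‿cong (*-congˡ (𝟙-no (a ℕ.+ b ℕ.<? n) (ℕP.≤⇒≯ n≤a+b)))))
    (solve 1 (λ x → con (+ 0) :- x :* con (+ 0) := con (+ 0)) refl x)

  entry-diagonal : ∀ n a → n ℕ.≤ a ℕ.+ a → entry n a a ≈ 1#
  entry-diagonal n a n≤a+a =
    trans (+-cong (𝟙-yes (a ℕ.≟ a) ≡.refl) (-‿cong (*-congˡ (𝟙-no (a ℕ.+ a ℕ.<? n) (ℕP.≤⇒≯ n≤a+a)))))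
    (solve 1 (λ x → con (+ 1) :- x :* con (+ 0) := con (+ 1)) refl x)

  entry-inside : ∀ n a b → a ≢ b → a ℕ.+ b ℕ.< n → entry n a b ≈ - x
  entry-inside n a b a≢b lt = trans (+-cong (𝟙-no (a ℕ.≟ b) a≢b) (-‿cong (*-congˡ (𝟙-yes (a ℕ.+ b ℕ.<? n) lt))))
    (solve 1 (λ x → con (+ 0) :- x :* con (+ 1) := :- x) refl x)

  detE : ℕ → Carrier
  detE n = det (tabulateℕ {n} (entry n))

  -- The (a, 0) cofactor of I − x A_(m+1), with its minor indexed by ℕ.
  cofactor₀ : ℕ → ℕ → Carrier
  cofactor₀ m a = sgn a * det (tabulateℕ {m} (λ r s → entry (suc m) (punchInℕ a r) (suc s)))

  cofactor-IxA : ∀ m (j : Fin (suc m)) → cofactor (IxA x (suc m)) j zero ≈ cofactor₀ m (toℕ j)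
  cofactor-IxA m j = *-cong (reflexive (≡.cong sgn (ℕP.+-identityʳ (toℕ j))))
    (det-cong (λ r s → trans (IxA≈entry (suc m) (punchIn j r) (suc s))
                             (reflexive (≡.cong (λ t → entry (suc m) t (suc (toℕ s))) (toℕ-punchIn j r)))))

  cofactor₀-zero : ∀ k → cofactor₀ (suc k) 0 ≈ detE k
  cofactor₀-zero k = begin
    1# * det (tabulateℕ {suc k} (λ r s → entry (suc (suc k)) (suc r) (suc s)))
      ≈⟨ *-identityˡ _ ⟩
    det (tabulateℕ {suc k} (λ r s → entry (suc (suc k)) (suc r) (suc s)))
      ≈⟨ det-tabulateℕ-cong (suc k) (λ a b _ _ → entry-suc k a b) ⟩
    det (tabulateℕ {suc k} (entry k))
      ≈⟨ det-last-row-unit k (entry k) (λ b b<k → entry-off k k b (ℕP.>⇒≢ b<k) (ℕP.m≤m+n k b))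
                                      (entry-diagonal k k (ℕP.m≤m+n k k)) ⟩
    detE k ∎

  cofactor₀-last : ∀ k → cofactor₀ (suc k) (suc k) ≈ x * detE k
  cofactor₀-last k = begin
      sgn (suc k) * det (tabulateℕ {suc k} (λ r s → entry (suc (suc k)) (punchInℕ (suc k) r) (suc s)))
    ≈⟨ *-congˡ (det-tabulateℕ-cong (suc k)
         (λ a b a<1+k _ → reflexive (≡.cong (λ t → T t b) (punchInℕ-< (suc k) a a<1+k)))) ⟩
      sgn (suc k) * det (tabulateℕ {suc k} T)
    ≈⟨ *-congˡ (det-last-column-top k T (λ a a<k → entry-off _ (suc a) (suc k) (ℕP.<⇒≢ (s≤s a<k))
                                                   (s≤s (ℕP.m≤n+m (suc k) a)))) ⟩
      (- sgn k) * (sgn k * (T 0 k * det (tabulateℕ {k} (λ a b → T (suc a) b))))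
    ≈⟨ *-congˡ (*-congˡ (*-cong (entry-inside _ 0 (suc k) ℕP.0≢1+n (ℕP.n<1+n (suc k)))
                                 (det-tabulateℕ-cong k (λ a b _ _ → entry-suc k a b)))) ⟩
      (- sgn k) * (sgn k * ((- x) * detE k))
    ≈⟨ regroup (sgn k) x (detE k) ⟩
      (sgn k * sgn k) * (x * detE k)
    ≈⟨ trans (*-congʳ (sgn-square k)) (*-identityˡ _) ⟩
      x * detE k ∎
    where
    T : ℕ → ℕ → Carrier
    T a b = entry (suc (suc k)) a (suc b)
    regroup : ∀ s x d → (- s) * (s * ((- x) * d)) ≈ (s * s) * (x * d)
    regroup = solve 3 (λ s x d → (:- s) :* (s :* ((:- x) :* d)) := (s :* s) :* (x :* d)) refl

  cofactor₀-one : ∀ k → cofactor₀ (suc (suc k)) 1 ≈ cofactor₀ k 0 - detE (suc k)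
  cofactor₀-one k = begin
      - 1# * det (tabulateℕ {suc (suc k)} f)
    ≈⟨ *-congˡ (det-last-row-unit (suc k) f
         (λ b b<1+k → entry-off _ (suc (suc k)) (suc b) (ℕP.>⇒≢ (s≤s b<1+k)) (s≤s (s≤s (ℕP.m<m+n k ℕ.z<s))))
         (entry-diagonal _ (suc (suc k)) (s≤s (s≤s (ℕP.m<m+n k ℕ.z<s))))) ⟩
      - 1# * det (tabulateℕ {suc k} f)
    ≈⟨ -1*x≈-x _ ⟩
      - det (tabulateℕ {suc k} f)
    ≈⟨ -‿cong (isolate
         (det-additive-row zero (tabulateℕ f) (tabulateℕ g) (tabulateℕ (entry (suc k))) others row₀)) ⟩
      - (detE (suc k) - det (tabulateℕ {suc k} g))
    ≈⟨ -‿cong (+-congˡ (-‿cong (trans (det-first-row-unit k g (λ b → refl) refl) (sym (*-identityˡ _))))) ⟩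
      - (detE (suc k) - cofactor₀ k 0)
    ≈⟨ solve 2 (λ d c → :- (d :- c) := c :- d) refl (detE (suc k)) (cofactor₀ k 0) ⟩
      cofactor₀ k 0 - detE (suc k) ∎
    where
    f g : ℕ → ℕ → Carrier
    f a b = entry (3 ℕ.+ k) (punchInℕ 1 a) (suc b)
    g zero    b = 𝟙 (b ℕ.≟ 0)
    g (suc a) b = entry (suc k) (suc a) b
    isolate : ∀ {p m n} → p ≈ m + n → m ≈ p - n
    isolate {p} {m} {n} p≈m+n = trans (solve 2 (λ m n → m := (m :+ n) :- n) refl m n) (+-congʳ (sym p≈m+n))
    others : ∀ r → r ≢ zero → ∀ s → (tabulateℕ {suc k} (entry (suc k)) r s ≈ tabulateℕ f r s)
                                  × (tabulateℕ {suc k} (entry (suc k)) r s ≈ tabulateℕ g r s)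
    others zero    r≢0 s = ⊥-elim (r≢0 ≡.refl)
    others (suc r) r≢0 s = sym (entry-suc (suc k) (suc (toℕ r)) (toℕ s)) , refl
    row₀ : ∀ s → tabulateℕ {suc k} (entry (suc k)) zero s ≈ tabulateℕ f zero s + tabulateℕ g zero s
    row₀ zero    = trans (+-cong (𝟙-yes (0 ℕ.≟ 0) ≡.refl) (-‿cong (*-congˡ (𝟙-yes (0 ℕ.<? suc k) (s≤s z≤n)))))
                  (trans (solve 1 (λ x → con (+ 1) :- x :* con (+ 1) := :- x :+ con (+ 1)) refl x)
                         (+-congʳ (sym (entry-inside (3 ℕ.+ k) 0 1 ℕP.0≢1+n (s≤s (s≤s z≤n))))))
    row₀ (suc s) = trans (entry-inside (suc k) 0 (suc (toℕ s)) ℕP.0≢1+n (FinP.toℕ<n (suc s)))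
                  (trans (sym (+-identityʳ _))
                         (+-congʳ (sym (entry-inside (3 ℕ.+ k) 0 (suc (suc (toℕ s))) ℕP.0≢1+n
                                                      (s≤s (s≤s (ℕP.m<n⇒m<1+n (FinP.toℕ<n s))))))))

  -- Row 1 minus row 0 of the minor is the unit vector e₀ (both rows lie inside the triangle except at
  -- the diagonal entry (1,1)); expanding along it and along the unit last row shrinks the size by two.
  cofactor₀-shift : ∀ m a → a ℕ.≤ m → cofactor₀ (3 ℕ.+ m) (2 ℕ.+ a) ≈ cofactor₀ (suc m) (suc a)
  cofactor₀-shift m a a≤m = begin
      sgn (2 ℕ.+ a) * det (tabulateℕ {3 ℕ.+ m} Q)
    ≈⟨ *-congˡ (det-last-row-unit (2 ℕ.+ m) Q last-row≈0 corner≈1) ⟩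
      sgn (2 ℕ.+ a) * det (tabulateℕ {2 ℕ.+ m} Q)
    ≈⟨ *-congˡ (det-add-row-multiple (tabulateℕ Q) (tabulateℕ Q′) (suc zero) zero (- 1#) (λ ()) others row₁) ⟨
      sgn (2 ℕ.+ a) * det (tabulateℕ {2 ℕ.+ m} Q′)
    ≈⟨ *-congˡ (det-second-row-unit m Q′ (λ b → refl) refl) ⟩
      (- sgn (suc a)) * (- det (tabulateℕ {suc m} (λ r s → Q′ (punchInℕ 1 r) (suc s))))
    ≈⟨ -a*-b≈a*b _ _ ⟩
      sgn (suc a) * det (tabulateℕ {suc m} (λ r s → Q′ (punchInℕ 1 r) (suc s)))
    ≈⟨ *-congˡ (det-tabulateℕ-cong (suc m) smaller) ⟩
      sgn (suc a) * det (tabulateℕ {suc m} (λ r s → entry (2 ℕ.+ m) (punchInℕ (suc a) r) (suc s))) ∎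
    where
    Q Q′ : ℕ → ℕ → Carrier
    Q r s = entry (4 ℕ.+ m) (punchInℕ (2 ℕ.+ a) r) (suc s)
    Q′ zero          s = Q zero s
    Q′ (suc zero)    s = 𝟙 (s ℕ.≟ 0)
    Q′ (suc (suc r)) s = Q (suc (suc r)) s
    top : punchInℕ (2 ℕ.+ a) (2 ℕ.+ m) ≡ 3 ℕ.+ m
    top = ≡.cong (λ t → suc (suc t)) (punchInℕ-≥ a m a≤m)
    last-row≈0 : ∀ b → b ℕ.< 2 ℕ.+ m → Q (2 ℕ.+ m) b ≈ 0#
    last-row≈0 b b<2+m = trans (reflexive (≡.cong (λ t → entry (4 ℕ.+ m) t (suc b)) top))
      (entry-off _ (3 ℕ.+ m) (suc b) (ℕP.>⇒≢ (s≤s b<2+m)) (s≤s (s≤s (s≤s (ℕP.m<m+n m ℕ.z<s)))))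
    corner≈1 : Q (2 ℕ.+ m) (2 ℕ.+ m) ≈ 1#
    corner≈1 = trans (reflexive (≡.cong (λ t → entry (4 ℕ.+ m) t (3 ℕ.+ m)) top))
      (entry-diagonal _ (3 ℕ.+ m) (s≤s (s≤s (s≤s (ℕP.m<m+n m ℕ.z<s)))))
    others : ∀ r → r ≢ suc zero → ∀ s → tabulateℕ {2 ℕ.+ m} Q′ r s ≈ tabulateℕ Q r s
    others zero          r≢1 s = refl
    others (suc zero)    r≢1 s = ⊥-elim (r≢1 ≡.refl)
    others (suc (suc r)) r≢1 s = refl
    row₁ : ∀ s → tabulateℕ {2 ℕ.+ m} Q′ (suc zero) s ≈ tabulateℕ Q (suc zero) s + (- 1#) * tabulateℕ Q zero s
    row₁ zero    = solve 1 (λ x → con (+ 1) := (con (+ 1) :- x :* con (+ 1)) :+ (:- con (+ 1)) :* (con (+ 0) :- x :* con (+ 1))) refl x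
    row₁ (suc s) = trans (solve 1 (λ x → con (+ 0) := (:- x) :+ (:- con (+ 1)) :* (:- x)) refl x)
      (sym (+-cong (entry-inside _ 1 (2 ℕ.+ toℕ s) (λ ()) (s≤s (s≤s (s≤s (FinP.toℕ<n s)))))
                   (*-congˡ (entry-inside _ 0 (2 ℕ.+ toℕ s) (λ ()) (s≤s (s≤s (ℕP.m<n⇒m<1+n (FinP.toℕ<n s))))))))
    smaller : ∀ r s → r ℕ.< suc m → s ℕ.< suc m →
      Q′ (punchInℕ 1 r) (suc s) ≈ entry (2 ℕ.+ m) (punchInℕ (suc a) r) (suc s)
    smaller zero    s _ s<1+m = trans (entry-inside _ 0 (2 ℕ.+ s) (λ ()) (s≤s (s≤s (ℕP.m<n⇒m<1+n s<1+m))))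
                                     (sym (entry-inside _ 0 (suc s) (λ ()) (s≤s s<1+m)))
    smaller (suc r) s _ _     = entry-suc (2 ℕ.+ m) (suc (punchInℕ a r)) (suc s)

  case-dec : ∀ {p} {Q : Set p} → Dec Q → Carrier → Carrier → Carrier
  case-dec d u v = if does d then u else v

  case-dec-yes : ∀ {p} {Q : Set p} (d : Dec Q) {u v} → Q → case-dec d u v ≈ u
  case-dec-yes (yes _) q = refl
  case-dec-yes (no ¬q) q = ⊥-elim (¬q q)

  case-dec-no : ∀ {p} {Q : Set p} (d : Dec Q) {u v} → ¬ Q → case-dec d u v ≈ v
  case-dec-no (yes q) ¬q = ⊥-elim (¬q q)
  case-dec-no (no _)  ¬q = refl

  -- The entries of the row differences of I - x A: a bidiagonal matrix minus x times the antidiagonal.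
  Dentry : ℕ → ℕ → ℕ → Carrier
  Dentry n a b = (𝟙 (a ℕ.≟ b) - 𝟙 (suc a ℕ.≟ b)) - x * 𝟙 (suc (a ℕ.+ b) ℕ.≟ n)

  -- Dentry with the last row replaced by e₀, and with the last row replaced by α e₀ + β e_k.
  Fentry : ℕ → ℕ → ℕ → Carrier
  Fentry k a b = case-dec (suc a ℕ.≟ k) (𝟙 (b ℕ.≟ 0)) (Dentry k a b)

  Hentry : ℕ → Carrier → Carrier → ℕ → ℕ → Carrier
  Hentry k α β a b = case-dec (a ℕ.≟ k) (α * 𝟙 (b ℕ.≟ 0) + β * 𝟙 (b ℕ.≟ k)) (Dentry k a b)

  detD detF : ℕ → Carrier
  detD k = det (tabulateℕ {k} (Dentry k))
  detF k = det (tabulateℕ {k} (Fentry k))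

  private
    values : ∀ {u v w a b d} → a ≈ u → b ≈ v → d ≈ w → u - v ≈ w → a - b ≈ d
    values a≈u b≈v d≈w u-v≈w = trans (+-cong a≈u (-‿cong b≈v)) (trans u-v≈w (sym d≈w))

  𝟙<-step : ∀ c n → 𝟙 (c ℕ.<? n) - 𝟙 (suc c ℕ.<? n) ≈ 𝟙 (suc c ℕ.≟ n)
  𝟙<-step c n with suc c ℕ.<? n | c ℕ.<? n | suc c ℕ.≟ n
  ... | yes c+1<n | _       | yes c+1≡n = ⊥-elim (ℕP.<-irrefl c+1≡n c+1<n)
  ... | yes c+1<n | yes c<n | no c+1≢n  = values (𝟙-yes (c ℕ.<? n) c<n) (𝟙-yes (suc c ℕ.<? n) c+1<n)
                                                (𝟙-no (suc c ℕ.≟ n) c+1≢n) (-‿inverseʳ 1#)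
  ... | yes c+1<n | no c≮n  | _         = ⊥-elim (c≮n (ℕP.<-trans (ℕP.n<1+n c) c+1<n))
  ... | no c+1≮n  | yes c<n | yes c+1≡n = values (𝟙-yes (c ℕ.<? n) c<n) (𝟙-no (suc c ℕ.<? n) c+1≮n)
                                                (𝟙-yes (suc c ℕ.≟ n) c+1≡n) (trans (+-congˡ -0#≈0#) (+-identityʳ 1#))
  ... | no c+1≮n  | yes c<n | no c+1≢n  = ⊥-elim (c+1≮n (ℕP.≤∧≢⇒< c<n c+1≢n))
  ... | no _      | no c≮n  | yes c+1≡n = ⊥-elim (c≮n (ℕP.≤-reflexive c+1≡n))
  ... | no c+1≮n  | no c≮n  | no c+1≢n  = values (𝟙-no (c ℕ.<? n) c≮n) (𝟙-no (suc c ℕ.<? n) c+1≮n)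
                                                (𝟙-no (suc c ℕ.≟ n) c+1≢n) (-‿inverseʳ 0#)

  entry-difference : ∀ n a b → entry n a b - entry n (suc a) b ≈ Dentry n a b
  entry-difference n a b = trans (regroup x _ _ _ _) (+-congˡ (-‿cong (*-congˡ (𝟙<-step (a ℕ.+ b) n))))
    where
    regroup : ∀ x i₁ l₁ i₂ l₂ → (i₁ - x * l₁) - (i₂ - x * l₂) ≈ (i₁ - i₂) - x * (l₁ - l₂)
    regroup = solve 5 (λ x i₁ l₁ i₂ l₂ → (i₁ :- x :* l₁) :- (i₂ :- x :* l₂)
                                         := (i₁ :- i₂) :- x :* (l₁ :- l₂)) refl

  detE≈detD : ∀ m → detE (suc m) ≈ detD (suc m)
  detE≈detD m = trans (sym (det-rowDifferences (tabulateℕ {suc m} (entry (suc m))))) (det-cong differences)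
    where
    differences : ∀ r s → rowDifferences (tabulateℕ {suc m} (entry (suc m))) r s ≈ Dentry (suc m) (toℕ r) (toℕ s)
    differences r s = trans (+-congˡ (-‿cong (nextRow-tabulateℕ (entry (suc m))
      (λ s → entry-off _ (suc m) (toℕ s) (ℕP.>⇒≢ (FinP.toℕ<n s)) (ℕP.m≤m+n (suc m) (toℕ s))) r s)))
      (entry-difference (suc m) (toℕ r) (toℕ s))

  Dentry-suc : ∀ k a b → Dentry (suc (suc k)) (suc a) (suc b) ≈ Dentry k a b
  Dentry-suc k a b = +-congˡ (-‿cong (*-congˡ (reflexive (≡.cong (λ t → 𝟙 (t ℕ.≟ k)) (ℕP.+-suc a b)))))

  Dentry-values : ∀ n a b {u v w} →
    𝟙 (a ℕ.≟ b) ≈ u → 𝟙 (suc a ℕ.≟ b) ≈ v → 𝟙 (suc (a ℕ.+ b) ℕ.≟ n) ≈ w →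
    Dentry n a b ≈ (u - v) - x * w
  Dentry-values n a b ≈u ≈v ≈w = +-cong (+-cong ≈u (-‿cong ≈v)) (-‿cong (*-congˡ ≈w))

  𝟙-sym : ∀ a b → 𝟙 (a ℕ.≟ b) ≈ 𝟙 (b ℕ.≟ a)
  𝟙-sym a b = 𝟙-cong ≡.sym ≡.sym (a ℕ.≟ b) (b ℕ.≟ a)

  𝟙-≢ : ∀ a b → a ≢ b → 𝟙 (a ℕ.≟ b) ≈ 0#
  𝟙-≢ a b = 𝟙-no (a ℕ.≟ b)

  private
    zero-value : ∀ x → (0# - 0#) - x * 0# ≈ 0#
    zero-value = solve 1 (λ x → (con (+ 0) :- con (+ 0)) :- x :* con (+ 0) := con (+ 0)) refl

    𝟙-suc[k+b]≟suc[k] : ∀ k b → 𝟙 (suc (k ℕ.+ b) ℕ.≟ suc k) ≈ 𝟙 (b ℕ.≟ 0)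
    𝟙-suc[k+b]≟suc[k] k b = 𝟙-cong to from (suc (k ℕ.+ b) ℕ.≟ suc k) (b ℕ.≟ 0)
      where
      to : suc (k ℕ.+ b) ≡ suc k → b ≡ 0
      to e = ℕP.+-cancelˡ-≡ k b 0 (≡.trans (ℕP.suc-injective e) (≡.sym (ℕP.+-identityʳ k)))
      from : b ≡ 0 → suc (k ℕ.+ b) ≡ suc k
      from ≡.refl = ≡.cong suc (ℕP.+-identityʳ k)

  Dentry-row₀ : ∀ m b → Dentry (suc m) 0 b ≈ (𝟙 (b ℕ.≟ 0) - 𝟙 (b ℕ.≟ 1)) - x * 𝟙 (b ℕ.≟ m)
  Dentry-row₀ m b = Dentry-values (suc m) 0 b (𝟙-sym 0 b) (𝟙-sym 1 b) refl

  Dentry-lastRow : ∀ m b → b ℕ.< suc m → Dentry (suc m) m b ≈ (𝟙 (b ℕ.≟ m) - 0#) - x * 𝟙 (b ℕ.≟ 0)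
  Dentry-lastRow m b b<1+m = Dentry-values (suc m) m b (𝟙-sym m b) (𝟙-≢ (suc m) b (ℕP.>⇒≢ b<1+m)) (𝟙-suc[k+b]≟suc[k] m b)

  Dentry-column₀ : ∀ m a → a ≢ 0 → a ≢ m → Dentry (suc m) a 0 ≈ 0#
  Dentry-column₀ m a a≢0 a≢m =
    trans (Dentry-values (suc m) a 0 (𝟙-≢ a 0 a≢0) refl (𝟙-≢ (suc (a ℕ.+ 0)) (suc m) (a≢m ∘ a+0≡m))) (zero-value x)
    where
    a+0≡m : suc (a ℕ.+ 0) ≡ suc m → a ≡ m
    a+0≡m e = ≡.trans (≡.sym (ℕP.+-identityʳ a)) (ℕP.suc-injective e)

  Dentry-00 : ∀ m → m ≢ 0 → Dentry (suc m) 0 0 ≈ 1#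
  Dentry-00 m m≢0 = trans (Dentry-values (suc m) 0 0 refl refl (𝟙-≢ 1 (suc m) (m≢0 ∘ ≡.sym ∘ ℕP.suc-injective)))
                          (solve 1 (λ x → (con (+ 1) :- con (+ 0)) :- x :* con (+ 0) := con (+ 1)) refl x)

  -- Hentry (suc k′) α β after adding β times row k′ to its last row.
  Hentry′ : ℕ → Carrier → Carrier → ℕ → ℕ → Carrier
  Hentry′ k′ α β a b =
    case-dec (a ℕ.≟ suc k′) ((α - β * x) * 𝟙 (b ℕ.≟ 0) + β * 𝟙 (b ℕ.≟ k′)) (Dentry (suc k′) a b)

  private
    module LastRows (k′ : ℕ) where
      iK ik′ : Fin (2 ℕ.+ k′)
      iK  = Fin.fromℕ (suc k′)
      ik′ = Fin.inject₁ (Fin.fromℕ k′)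
      toℕ-iK : toℕ iK ≡ suc k′
      toℕ-iK = FinP.toℕ-fromℕ (suc k′)
      toℕ-ik′ : toℕ ik′ ≡ k′
      toℕ-ik′ = ≡.trans (FinP.toℕ-inject₁ (Fin.fromℕ k′)) (FinP.toℕ-fromℕ k′)
      iK≢ik′ : iK ≢ ik′
      iK≢ik′ e = ℕP.1+n≢n (≡.trans (≡.sym toℕ-iK) (≡.trans (≡.cong toℕ e) toℕ-ik′))

  det-Hentry : ∀ k′ α β →
    det (tabulateℕ {2 ℕ.+ k′} (Hentry (suc k′) α β)) ≈ det (tabulateℕ {2 ℕ.+ k′} (Hentry′ k′ α β))
  det-Hentry k′ α β = sym (det-add-row-multiple (tabulateℕ H) (tabulateℕ H′) iK ik′ β iK≢ik′ others lastRow)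
    where
    open LastRows k′
    K = suc k′
    H H′ : ℕ → ℕ → Carrier
    H  = Hentry K α β
    H′ = Hentry′ k′ α β
    others : ∀ r → r ≢ iK → ∀ s → tabulateℕ {suc K} H′ r s ≈ tabulateℕ H r s
    others r r≢iK s = trans (case-dec-no (toℕ r ℕ.≟ K) r≢K) (sym (case-dec-no (toℕ r ℕ.≟ K) r≢K))
      where
      r≢K : toℕ r ≢ K
      r≢K e = r≢iK (FinP.toℕ-injective (≡.trans e (≡.sym toℕ-iK)))
    lastRowℕ : ∀ b → H′ K b ≈ H K b + β * H k′ b
    lastRowℕ b = begin
        H′ K b
      ≈⟨ case-dec-yes (K ℕ.≟ K) ≡.refl ⟩
        (α - β * x) * 𝟙 (b ℕ.≟ 0) + β * 𝟙 (b ℕ.≟ k′)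
      ≈⟨ split α β x (𝟙 (b ℕ.≟ 0)) (𝟙 (b ℕ.≟ k′)) (𝟙 (b ℕ.≟ K)) ⟩
        (α * 𝟙 (b ℕ.≟ 0) + β * 𝟙 (b ℕ.≟ K)) + β * ((𝟙 (b ℕ.≟ k′) - 𝟙 (b ℕ.≟ K)) - x * 𝟙 (b ℕ.≟ 0))
      ≈⟨ +-cong (case-dec-yes (K ℕ.≟ K) ≡.refl)
                (*-congˡ (trans (case-dec-no (k′ ℕ.≟ K) (ℕP.1+n≢n ∘ ≡.sym))
                                (Dentry-values K k′ b (𝟙-sym k′ b) (𝟙-sym K b) (𝟙-suc[k+b]≟suc[k] k′ b)))) ⟨
        H K b + β * H k′ b ∎
      where
      split : ∀ α β x i₀ j iₖ → (α - β * x) * i₀ + β * j ≈ (α * i₀ + β * iₖ) + β * ((j - iₖ) - x * i₀)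
      split = solve 6 (λ α β x i₀ j iₖ → (α :- β :* x) :* i₀ :+ β :* j
                                         := (α :* i₀ :+ β :* iₖ) :+ β :* ((j :- iₖ) :- x :* i₀)) refl
    lastRow : ∀ s → tabulateℕ H′ iK s ≈ tabulateℕ H iK s + β * tabulateℕ H ik′ s
    lastRow s = ≡.subst₂ (λ a c → H′ a (toℕ s) ≈ H a (toℕ s) + β * H c (toℕ s)) (≡.sym toℕ-iK) (≡.sym toℕ-ik′)
                         (lastRowℕ (toℕ s))

  -- The only nonzero entry of the last column is −1, in row k′.
  det-Hentry′-expand : ∀ k′ α β → det (tabulateℕ {2 ℕ.+ k′} (Hentry′ k′ α β))
                                ≈ det (tabulateℕ {suc k′} (λ a b → Hentry′ k′ α β (punchInℕ k′ a) b))
  det-Hentry′-expand k′ α β = begin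
      det (tabulateℕ {suc K} H′)
    ≈⟨ det-column-singleton (tabulateℕ H′) ik′ iK column≈0 ⟩
      sgn (toℕ ik′) * (sgn (toℕ iK) * (H′ (toℕ ik′) (toℕ iK) * det (minor ik′ iK (tabulateℕ H′))))
    ≡⟨ ≡.cong₂ (λ a c → sgn a * (sgn c * (H′ a c * det (minor ik′ iK (tabulateℕ H′))))) toℕ-ik′ toℕ-iK ⟩
      sgn k′ * ((- sgn k′) * (H′ k′ K * det (minor ik′ iK (tabulateℕ H′))))
    ≈⟨ *-congˡ (*-congˡ (*-cong corner (det-cong {N = tabulateℕ {K} (λ a b → H′ (punchInℕ k′ a) b)} minor≈))) ⟩
      sgn k′ * ((- sgn k′) * ((- 1#) * det (tabulateℕ {K} (λ a b → H′ (punchInℕ k′ a) b))))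
    ≈⟨ trans (regroup (sgn k′) _) (trans (*-congʳ (sgn-square k′)) (*-identityˡ _)) ⟩
      det (tabulateℕ {K} (λ a b → H′ (punchInℕ k′ a) b)) ∎
    where
    open LastRows k′
    K = suc k′
    H′ : ℕ → ℕ → Carrier
    H′ = Hentry′ k′ α β
    regroup : ∀ s d → s * ((- s) * ((- 1#) * d)) ≈ (s * s) * d
    regroup = solve 2 (λ s d → s :* ((:- s) :* ((:- con (+ 1)) :* d)) := (s :* s) :* d) refl
    columnℕ≈0 : ∀ a → a ≢ k′ → H′ a K ≈ 0#
    columnℕ≈0 a a≢k′ with a ℕ.≟ K
    ... | yes ≡.refl = trans (case-dec-yes (K ℕ.≟ K) ≡.refl)
                             (trans (+-cong (zeroʳ _) (*-congˡ (𝟙-≢ K k′ ℕP.1+n≢n)))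
                                    (trans (+-congˡ (zeroʳ β)) (+-identityʳ 0#)))
    ... | no a≢K    = trans (case-dec-no (a ℕ.≟ K) a≢K)
                        (trans (Dentry-values K a K (𝟙-≢ a K a≢K) (𝟙-≢ (suc a) K (a≢k′ ∘ ℕP.suc-injective))
                                              (𝟙-≢ (suc (a ℕ.+ K)) K (ℕP.m≢1+n+m K ∘ ≡.sym)))
                               (zero-value x))
    column≈0 : ∀ r → r ≢ ik′ → tabulateℕ {suc K} H′ r iK ≈ 0#
    column≈0 r r≢ik′ = ≡.subst (λ c → H′ (toℕ r) c ≈ 0#) (≡.sym toℕ-iK)
      (columnℕ≈0 (toℕ r) (λ e → r≢ik′ (FinP.toℕ-injective (≡.trans e (≡.sym toℕ-ik′)))))
    corner : H′ k′ K ≈ - 1#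
    corner = trans (case-dec-no (k′ ℕ.≟ K) (ℕP.1+n≢n ∘ ≡.sym))
      (trans (Dentry-values K k′ K (𝟙-≢ k′ K (ℕP.1+n≢n ∘ ≡.sym)) (𝟙-yes (K ℕ.≟ K) ≡.refl)
                                   (𝟙-≢ (suc (k′ ℕ.+ K)) K (ℕP.m≢1+n+m K ∘ ≡.sym)))
             (solve 1 (λ x → (con (+ 0) :- con (+ 1)) :- x :* con (+ 0) := :- con (+ 1)) refl x))
    minor≈ : ∀ r s → minor ik′ iK (tabulateℕ H′) r s ≈ H′ (punchInℕ k′ (toℕ r)) (toℕ s)
    minor≈ r s = reflexive (≡.cong₂ H′ (≡.trans (toℕ-punchIn ik′ r) (≡.cong (λ t → punchInℕ t (toℕ r)) toℕ-ik′))
                                       (toℕ-punchIn-last s))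

  -- The last row (α - β x) e₀ + β e_k′ is β times the last row of Dentry plus α times that of Fentry.
  det-Hentry′ : ∀ k′ α β → det (tabulateℕ {suc k′} (λ a b → Hentry′ k′ α β (punchInℕ k′ a) b))
                         ≈ β * detD (suc k′) + α * detF (suc k′)
  det-Hentry′ k′ α β =
    det-linear-combination-row (Fin.fromℕ k′) α β (tabulateℕ (Dentry K)) (tabulateℕ (Fentry K)) (tabulateℕ G) others lastRow
    where
    K = suc k′
    G : ℕ → ℕ → Carrier
    G a b = Hentry′ k′ α β (punchInℕ k′ a) b
    others : ∀ r → r ≢ Fin.fromℕ k′ → ∀ s → (tabulateℕ {K} G r s ≈ tabulateℕ (Dentry K) r s)
                                           × (tabulateℕ {K} G r s ≈ tabulateℕ (Fentry K) r s)
    others r r≢k′ s = trans G≈ (case-dec-no (toℕ r ℕ.≟ K) r≢K)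
                    , trans G≈ (trans (case-dec-no (toℕ r ℕ.≟ K) r≢K)
                                      (sym (case-dec-no (suc (toℕ r) ℕ.≟ K) (r≢k′′ ∘ ℕP.suc-injective))))
      where
      r≢k′′ : toℕ r ≢ k′
      r≢k′′ e = r≢k′ (FinP.toℕ-injective (≡.trans e (≡.sym (FinP.toℕ-fromℕ k′))))
      r<k′ : toℕ r ℕ.< k′
      r<k′ = ℕP.≤∧≢⇒< (ℕP.≤-pred (FinP.toℕ<n r)) r≢k′′
      r≢K : toℕ r ≢ K
      r≢K = ℕP.<⇒≢ (ℕP.m<n⇒m<1+n r<k′)
      G≈ : G (toℕ r) (toℕ s) ≈ Hentry′ k′ α β (toℕ r) (toℕ s)
      G≈ = reflexive (≡.cong (λ t → Hentry′ k′ α β t (toℕ s)) (punchInℕ-< k′ (toℕ r) r<k′))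
    lastRowℕ : ∀ b → b ℕ.< K → G k′ b ≈ β * Dentry K k′ b + α * Fentry K k′ b
    lastRowℕ b b<K = begin
        G k′ b
      ≡⟨ ≡.cong (λ t → Hentry′ k′ α β t b) (punchInℕ-≥ k′ k′ ℕP.≤-refl) ⟩
        Hentry′ k′ α β K b
      ≈⟨ case-dec-yes (K ℕ.≟ K) ≡.refl ⟩
        (α - β * x) * 𝟙 (b ℕ.≟ 0) + β * 𝟙 (b ℕ.≟ k′)
      ≈⟨ split α β x (𝟙 (b ℕ.≟ 0)) (𝟙 (b ℕ.≟ k′)) ⟩
        β * ((𝟙 (b ℕ.≟ k′) - 0#) - x * 𝟙 (b ℕ.≟ 0)) + α * 𝟙 (b ℕ.≟ 0)
      ≈⟨ +-cong (*-congˡ (Dentry-lastRow k′ b b<K)) (*-congˡ (case-dec-yes (K ℕ.≟ K) ≡.refl)) ⟨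
        β * Dentry K k′ b + α * Fentry K k′ b ∎
      where
      split : ∀ α β x i₀ j → (α - β * x) * i₀ + β * j ≈ β * ((j - 0#) - x * i₀) + α * i₀
      split = solve 5 (λ α β x i₀ j → (α :- β :* x) :* i₀ :+ β :* j := β :* ((j :- con (+ 0)) :- x :* i₀) :+ α :* i₀) refl
    lastRow : ∀ s → tabulateℕ {K} G (Fin.fromℕ k′) s
                  ≈ β * tabulateℕ (Dentry K) (Fin.fromℕ k′) s + α * tabulateℕ (Fentry K) (Fin.fromℕ k′) s
    lastRow s = ≡.subst (λ a → G a (toℕ s) ≈ β * Dentry K a (toℕ s) + α * Fentry K a (toℕ s))
                        (≡.sym (FinP.toℕ-fromℕ k′)) (lastRowℕ (toℕ s) (FinP.toℕ<n s))

  detH : ∀ k′ α β → det (tabulateℕ {2 ℕ.+ k′} (Hentry (suc k′) α β)) ≈ β * detD (suc k′) + α * detF (suc k′)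
  detH k′ α β = trans (det-Hentry k′ α β) (trans (det-Hentry′-expand k′ α β) (det-Hentry′ k′ α β))

  detD-step : ∀ k′ → detD (3 ℕ.+ k′) ≈ (1# - x * x) * detD (suc k′) + (- x) * detF (suc k′)
  detD-step k′ = begin
      detD n
    ≈⟨ det-clear-column₀ (suc k′) (Dentry n) G x others lastRow column₀≈0 (Dentry-00 m (λ ())) ⟩
      det (tabulateℕ {m} (λ a b → G (suc a) (suc b)))
    ≈⟨ det-tabulateℕ-cong m lower≈H ⟩
      det (tabulateℕ {m} (Hentry (suc k′) (- x) (1# - x * x)))
    ≈⟨ detH k′ (- x) (1# - x * x) ⟩
      (1# - x * x) * detD (suc k′) + (- x) * detF (suc k′) ∎
    where
    m = 2 ℕ.+ k′
    n = 3 ℕ.+ k′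
    G : ℕ → ℕ → Carrier
    G a b = case-dec (a ℕ.≟ m) ((1# - x * x) * 𝟙 (b ℕ.≟ m) + (- x) * 𝟙 (b ℕ.≟ 1)) (Dentry n a b)
    others : ∀ a b → a ≢ m → G a b ≈ Dentry n a b
    others a b a≢m = case-dec-no (a ℕ.≟ m) a≢m
    lastRow : ∀ b → b ℕ.< n → G m b ≈ Dentry n m b + x * Dentry n 0 b
    lastRow b b<n = trans (case-dec-yes (m ℕ.≟ m) ≡.refl)
      (trans (split x _ _ _) (sym (+-cong (Dentry-lastRow m b b<n) (*-congˡ (Dentry-row₀ m b)))))
      where
      split : ∀ x l o z → (1# - x * x) * l + (- x) * o ≈ ((l - 0#) - x * z) + x * ((z - o) - x * l)
      split = solve 4 (λ x l o z → (con (+ 1) :- x :* x) :* l :+ (:- x) :* o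
                                   := ((l :- con (+ 0)) :- x :* z) :+ x :* ((z :- o) :- x :* l)) refl
    column₀≈0 : ∀ a → a ℕ.≤ suc k′ → G (suc a) 0 ≈ 0#
    column₀≈0 a _ with suc a ℕ.≟ m
    ... | yes a+1≡m = trans (case-dec-yes (suc a ℕ.≟ m) a+1≡m) (trans (+-cong (zeroʳ _) (zeroʳ _)) (+-identityʳ 0#))
    ... | no a+1≢m  = trans (case-dec-no (suc a ℕ.≟ m) a+1≢m) (Dentry-column₀ m (suc a) (λ ()) a+1≢m)
    lower≈H : ∀ a b → a ℕ.< m → b ℕ.< m → G (suc a) (suc b) ≈ Hentry (suc k′) (- x) (1# - x * x) a b
    lower≈H a b _ _ with a ℕ.≟ suc k′
    ... | yes a≡k′+1 = trans (case-dec-yes (suc a ℕ.≟ m) (≡.cong suc a≡k′+1))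
                             (trans (+-comm _ _) (sym (case-dec-yes (a ℕ.≟ suc k′) a≡k′+1)))
    ... | no a≢k′+1  = trans (case-dec-no (suc a ℕ.≟ m) (a≢k′+1 ∘ ℕP.suc-injective))
                             (trans (Dentry-suc (suc k′) a b) (sym (case-dec-no (a ℕ.≟ suc k′) a≢k′+1)))

  detF-step : ∀ k′ → detF (3 ℕ.+ k′) ≈ x * detD (suc k′) + 1# * detF (suc k′)
  detF-step k′ = begin
      detF n
    ≈⟨ det-clear-column₀ (suc k′) (Fentry n) G (- 1#) others lastRow column₀≈0 (Dentry-00 m (λ ())) ⟩
      det (tabulateℕ {m} (λ a b → G (suc a) (suc b)))
    ≈⟨ det-tabulateℕ-cong m lower≈H ⟩
      det (tabulateℕ {m} (Hentry (suc k′) 1# x))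
    ≈⟨ detH k′ 1# x ⟩
      x * detD (suc k′) + 1# * detF (suc k′) ∎
    where
    m = 2 ℕ.+ k′
    n = 3 ℕ.+ k′
    G : ℕ → ℕ → Carrier
    G a b = case-dec (a ℕ.≟ m) (𝟙 (b ℕ.≟ 1) + x * 𝟙 (b ℕ.≟ m)) (Fentry n a b)
    others : ∀ a b → a ≢ m → G a b ≈ Fentry n a b
    others a b a≢m = case-dec-no (a ℕ.≟ m) a≢m
    lastRow : ∀ b → b ℕ.< n → G m b ≈ Fentry n m b + (- 1#) * Fentry n 0 b
    lastRow b _ = trans (case-dec-yes (m ℕ.≟ m) ≡.refl)
      (trans (split x _ _ _) (sym (+-cong (case-dec-yes (suc m ℕ.≟ n) ≡.refl) (*-congˡ (Dentry-row₀ m b)))))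
      where
      split : ∀ x l o z → o + x * l ≈ z + (- 1#) * ((z - o) - x * l)
      split = solve 4 (λ x l o z → o :+ x :* l := z :+ (:- con (+ 1)) :* ((z :- o) :- x :* l)) refl
    column₀≈0 : ∀ a → a ℕ.≤ suc k′ → G (suc a) 0 ≈ 0#
    column₀≈0 a _ with suc a ℕ.≟ m
    ... | yes a+1≡m = trans (case-dec-yes (suc a ℕ.≟ m) a+1≡m) (trans (+-identityˡ _) (zeroʳ x))
    ... | no a+1≢m  = trans (case-dec-no (suc a ℕ.≟ m) a+1≢m)
                        (trans (case-dec-no (suc (suc a) ℕ.≟ n) (a+1≢m ∘ ℕP.suc-injective))
                               (Dentry-column₀ m (suc a) (λ ()) a+1≢m))
    lower≈H : ∀ a b → a ℕ.< m → b ℕ.< m → G (suc a) (suc b) ≈ Hentry (suc k′) 1# x a b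
    lower≈H a b _ _ with a ℕ.≟ suc k′
    ... | yes a≡k′+1 = trans (case-dec-yes (suc a ℕ.≟ m) (≡.cong suc a≡k′+1))
                             (trans (+-congʳ (sym (*-identityˡ _))) (sym (case-dec-yes (a ℕ.≟ suc k′) a≡k′+1)))
    ... | no a≢k′+1  = trans (case-dec-no (suc a ℕ.≟ m) (a≢k′+1 ∘ ℕP.suc-injective))
                        (trans (case-dec-no (suc (suc a) ℕ.≟ n) (a≢k′+1 ∘ ℕP.suc-injective ∘ ℕP.suc-injective))
                          (trans (Dentry-suc (suc k′) a b) (sym (case-dec-no (a ℕ.≟ suc k′) a≢k′+1))))

  detD-1 : detD 1 ≈ 1# - x
  detD-1 = trans (det-1×1 (tabulateℕ (Dentry 1)))
                 (solve 1 (λ x → (con (+ 1) :- con (+ 0)) :- x :* con (+ 1) := con (+ 1) :- x) refl x)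

  detF-1 : detF 1 ≈ 1#
  detF-1 = det-1×1 (tabulateℕ (Fentry 1))

  detD-2 : detD 2 ≈ (1# - x) - x * x
  detD-2 = trans (det-2×2 (tabulateℕ (Dentry 2)))
    (solve 1 (λ x → ((con (+ 1) :- con (+ 0)) :- x :* con (+ 0)) :* ((con (+ 1) :- con (+ 0)) :- x :* con (+ 0))
                    :- ((con (+ 0) :- con (+ 1)) :- x :* con (+ 1)) :* ((con (+ 0) :- con (+ 0)) :- x :* con (+ 1))
                    := (con (+ 1) :- x) :- x :* x) refl x)

  detF-2 : detF 2 ≈ 1# + x
  detF-2 = trans (det-2×2 (tabulateℕ (Fentry 2)))
    (solve 1 (λ x → ((con (+ 1) :- con (+ 0)) :- x :* con (+ 0)) :* con (+ 0)
                    :- ((con (+ 0) :- con (+ 1)) :- x :* con (+ 1)) :* con (+ 1) := con (+ 1) :+ x) refl x)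

  P-recurrence-neg : ∀ m → P (2 ℕ.+ m) (- x) ≈ P m (- x) + x * P (suc m) x
  P-recurrence-neg m = trans (P-recurrence m (- x)) (+-congˡ (*-cong (-‿involutive x) (P-cong (suc m) (-‿involutive x))))

  detD-detF : ∀ m → detD (suc m) ≈ P (suc m) x × detF (suc m) ≈ P m (- x)
  detD-detF m = proj₁ (consecutive m)
    where
    consecutive : ∀ m → (detD (suc m) ≈ P (suc m) x × detF (suc m) ≈ P m (- x))
                      × (detD (2 ℕ.+ m) ≈ P (2 ℕ.+ m) x × detF (2 ℕ.+ m) ≈ P (suc m) (- x))
    consecutive zero = (trans detD-1 (sym (P-1 x)) , trans detF-1 (sym (P-0 (- x))))
                     , (trans detD-2 (sym P₂) , trans detF-2 (sym (trans (P-1 (- x)) (1--x≈1+x x))))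
      where
      1--x≈1+x : ∀ x → 1# - (- x) ≈ 1# + x
      1--x≈1+x = solve 1 (λ x → con (+ 1) :- (:- x) := con (+ 1) :+ x) refl
      P₂ : P 2 x ≈ (1# - x) - x * x
      P₂ = trans (P-recurrence 0 x) (trans (+-cong (P-0 x) (*-congˡ (P-1 (- x))))
             (solve 1 (λ x → con (+ 1) :+ (:- x) :* (con (+ 1) :- (:- x)) := (con (+ 1) :- x) :- x :* x) refl x))
    consecutive (suc m) = proj₂ (consecutive m) , (detD≈ , detF≈)
      where
      D≈ = proj₁ (proj₁ (consecutive m))
      F≈ = proj₂ (proj₁ (consecutive m))
      detD≈ : detD (3 ℕ.+ m) ≈ P (3 ℕ.+ m) x
      detD≈ = begin
        detD (3 ℕ.+ m)                                        ≈⟨ detD-step m ⟩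
        (1# - x * x) * detD (suc m) + (- x) * detF (suc m)    ≈⟨ +-cong (*-congˡ D≈) (*-congˡ F≈) ⟩
        (1# - x * x) * P (suc m) x + (- x) * P m (- x)        ≈⟨ regroup x _ _ ⟩
        P (suc m) x + (- x) * (P m (- x) + x * P (suc m) x)   ≈⟨ +-congˡ (*-congˡ (P-recurrence-neg m)) ⟨
        P (suc m) x + (- x) * P (2 ℕ.+ m) (- x)               ≈⟨ P-recurrence (suc m) x ⟨
        P (3 ℕ.+ m) x                                         ∎
        where
        regroup : ∀ x p q → (1# - x * x) * p + (- x) * q ≈ p + (- x) * (q + x * p)
        regroup = solve 3 (λ x p q → (con (+ 1) :- x :* x) :* p :+ (:- x) :* q := p :+ (:- x) :* (q :+ x :* p)) refl
      detF≈ : detF (3 ℕ.+ m) ≈ P (2 ℕ.+ m) (- x)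
      detF≈ = begin
        detF (3 ℕ.+ m)                             ≈⟨ detF-step m ⟩
        x * detD (suc m) + 1# * detF (suc m)       ≈⟨ +-cong (*-congˡ D≈) (*-congˡ F≈) ⟩
        x * P (suc m) x + 1# * P m (- x)           ≈⟨ trans (+-comm _ _) (+-congʳ (*-identityˡ _)) ⟩
        P m (- x) + x * P (suc m) x                ≈⟨ P-recurrence-neg m ⟨
        P (2 ℕ.+ m) (- x)                          ∎

  detE≈P : ∀ n → detE n ≈ P n x
  detE≈P zero    = sym (P-0 x)
  detE≈P (suc m) = trans (detE≈detD m) (proj₁ (detD-detF m))

  cofactor₀-middle : ∀ t s → cofactor₀ (2 ℕ.+ (t ℕ.+ t ℕ.+ s)) (suc t) ≈ x * P s (- x)
  cofactor₀-middle zero zero = begin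
    cofactor₀ 2 1               ≈⟨ cofactor₀-one 0 ⟩
    1# * 1# - detE 1            ≈⟨ +-cong (*-identityˡ 1#) (-‿cong (detE≈P 1)) ⟩
    1# - P 1 x                  ≈⟨ +-congˡ (-‿cong (P-1 x)) ⟩
    1# - (1# - x)               ≈⟨ solve 1 (λ x → con (+ 1) :- (con (+ 1) :- x) := x :* con (+ 1)) refl x ⟩
    x * 1#                      ≈⟨ *-congˡ (P-0 (- x)) ⟨
    x * P 0 (- x)               ∎
  cofactor₀-middle zero (suc s) = begin
    cofactor₀ (3 ℕ.+ s) 1                    ≈⟨ cofactor₀-one (suc s) ⟩
    cofactor₀ (suc s) 0 - detE (2 ℕ.+ s)
      ≈⟨ +-cong (trans (cofactor₀-zero s) (detE≈P s)) (-‿cong (detE≈P (2 ℕ.+ s))) ⟩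
    P s x - P (2 ℕ.+ s) x                    ≈⟨ +-congˡ (-‿cong (P-recurrence s x)) ⟩
    P s x - (P s x + (- x) * P (suc s) (- x)) ≈⟨ solve 3 (λ x p q → p :- (p :+ (:- x) :* q) := x :* q) refl x _ _ ⟩
    x * P (suc s) (- x)                      ∎
  cofactor₀-middle (suc t) s = begin
    cofactor₀ (2 ℕ.+ (suc t ℕ.+ suc t ℕ.+ s)) (2 ℕ.+ t)
      ≡⟨ ≡.cong (λ u → cofactor₀ (2 ℕ.+ (suc u ℕ.+ s)) (2 ℕ.+ t)) (ℕP.+-suc t t) ⟩
    cofactor₀ (3 ℕ.+ suc (t ℕ.+ t ℕ.+ s)) (2 ℕ.+ t)
      ≈⟨ cofactor₀-shift (suc (t ℕ.+ t ℕ.+ s)) t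
           (ℕP.m≤n⇒m≤1+n (ℕP.≤-trans (ℕP.m≤m+n t t) (ℕP.m≤m+n (t ℕ.+ t) s))) ⟩
    cofactor₀ (2 ℕ.+ (t ℕ.+ t ℕ.+ s)) (suc t)
      ≈⟨ cofactor₀-middle t s ⟩
    x * P s (- x) ∎

  cofactor₀-upper : ∀ d s → cofactor₀ (suc (d ℕ.+ d ℕ.+ s)) (suc (d ℕ.+ s)) ≈ x * P s x
  cofactor₀-upper zero    s = trans (cofactor₀-last s) (*-congˡ (detE≈P s))
  cofactor₀-upper (suc d) s = begin
    cofactor₀ (suc (suc d ℕ.+ suc d ℕ.+ s)) (2 ℕ.+ (d ℕ.+ s))
      ≡⟨ ≡.cong (λ u → cofactor₀ (2 ℕ.+ (u ℕ.+ s)) (2 ℕ.+ (d ℕ.+ s))) (ℕP.+-suc d d) ⟩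
    cofactor₀ (3 ℕ.+ (d ℕ.+ d ℕ.+ s)) (2 ℕ.+ (d ℕ.+ s))
      ≈⟨ cofactor₀-shift (d ℕ.+ d ℕ.+ s) (d ℕ.+ s) (ℕP.+-monoˡ-≤ s (ℕP.m≤n+m d d)) ⟩
    cofactor₀ (suc (d ℕ.+ d ℕ.+ s)) (suc (d ℕ.+ s))
      ≈⟨ cofactor₀-upper d s ⟩
    x * P s x ∎

  adj-first-row : ∀ m (r j : Fin (suc m)) → toℕ r ≡ 0 → adj (IxA x (suc m)) r j ≈ cofactor₀ m (toℕ j)
  adj-first-row m zero j _ = cofactor-IxA m j

open import Data.Nat using (_≤_; _<_; _∸_; _+_; _*_)
open import Data.Nat.DivMod using (_/_)
open import Data.Fin as Fin using (Fin; toℕ)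
open import Data.Product using (_×_; _,_)

proposition4p14 : ∀ {c ℓ : Level} (R : CommutativeRing c ℓ) (x : CommutativeRing.Carrier R)
    (n : ℕ) → 2 ≤ n →
    let module Rg = CommutativeRing R
        open WithRing R
    in ((r j : Fin n) → toℕ r ≡ 0 → suc (toℕ j) ≡ 1 →
          adj (IxA x n) r j Rg.≈ P (n ∸ 2) x)
       × ((r j : Fin n) → toℕ r ≡ 0 → 1 < suc (toℕ j) → suc (toℕ j) < (n + 1) / 2 + 1 →
          adj (IxA x n) r j Rg.≈ x Rg.* P (n + 1 ∸ 2 * suc (toℕ j)) (Rg.- x))
       × ((r j : Fin n) → toℕ r ≡ 0 → (n + 1) / 2 < suc (toℕ j) → suc (toℕ j) ≤ n →
          adj (IxA x n) r j Rg.≈ x Rg.* P (2 * suc (toℕ j) ∸ (n + 2)) x)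
proposition4p14 R x (suc zero) (s≤s ())
proposition4p14 R x n@(suc (suc k)) _ =
    (λ { r Fin.zero r≡0 _ → trans (adj-first-row (suc k) r Fin.zero r≡0) (trans (cofactor₀-zero k) (detE≈P k))
       ; r (Fin.suc j) _ () })
  , (λ { r Fin.zero _ (s≤s ()) _
       ; r (Fin.suc j) r≡0 _ j<half → let t = toℕ j; s = n + 1 ∸ 2 * suc (suc t) in
           trans (adj-first-row (suc k) r (Fin.suc j) r≡0)
                 (trans (reflexive (≡.cong (λ m → cofactor₀ m (suc t)) (ℕP.suc-injective (middle-size t n j<half))))
                        (cofactor₀-middle t s)) })
  , λ r j r≡0 half<j j≤n → let (n≡ , j≡) = upper-size n (toℕ j) half<j j≤n in
      trans (adj-first-row (suc k) r j r≡0)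
            (trans (reflexive (≡.cong₂ cofactor₀ (ℕP.suc-injective n≡) j≡))
                   (cofactor₀-upper (n ∸ suc (toℕ j)) (2 * suc (toℕ j) ∸ (n + 2))))
  where
  open CommutativeRing R using (trans; reflexive)
  open IMinusxA R x
  open IndexArithmetic
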